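{- For $n\ge0$, let $T_n\subset\mathbb{C}$ be a configuration of $n+1$ points $x_1,\dots,x_n,y$ such that $x_1,\dots,x_n$ lie on a common line and $y$ does not lie on that line, and let $t_n=|\textsc{NC}(T_n)|$. Then \[\sum_{n\ge0}t_nx^n=\frac{(1-x)^2}{(1-2x)^2}.\]
   Context: For a finite set $P\subset\mathbb{C}$, a partition of $P$ is noncrossing if the convex hulls of its blocks are pairwise disjoint; $\textsc{NC}(P)$ denotes the set of noncrossing partitions of $P$. (For $n=0$, $T_0=\{y\}$ is a single point.) -}

module Defs where

open import Level using (Level; _⊔_)
open import Data.Nat as ℕ using (ℕ)
open import Data.Fin as Fin using (Fin)
open import Data.Bool using (Bool; true; false)
open import Data.Product using (Σ; ∃; _×_; _,_; proj₁; proj₂)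
open import Data.Integer as ℤ using (ℤ)
open import Relation.Binary.PropositionalEquality using (_≡_)
open import Relation.Nullary using (¬_)
open import Algebra.Bundles using (CommutativeRing)
open import Relation.Binary.Structures using (IsTotalOrder)

-- Ordered fields (the real numbers are one; ℂ is modelled as F × F)

record OrderedField (c ℓ₁ ℓ₂ : Level) : Set (Level.suc (c ⊔ ℓ₁ ⊔ ℓ₂)) where
  field
    commRing : CommutativeRing c ℓ₁
  open CommutativeRing commRing public
  field
    _≤_          : Carrier → Carrier → Set ℓ₂
    isTotalOrder : IsTotalOrder _≈_ _≤_
    +-monoˡ-≤    : ∀ {x y} z → x ≤ y → (x + z) ≤ (y + z)
    0≤*          : ∀ {x y} → 0# ≤ x → 0# ≤ y → 0# ≤ (x * y)
    0≉1          : ¬ (0# ≈ 1#)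
    inverse      : ∀ x → ¬ (x ≈ 0#) → ∃ λ y → (x * y) ≈ 1#

record Partition (m : ℕ) : Set where
  field
    rel   : Fin m → Fin m → Bool
    reflP : ∀ i → rel i i ≡ true
    symP  : ∀ i j → rel i j ≡ true → rel j i ≡ true
    transP : ∀ i j k → rel i j ≡ true → rel j k ≡ true → rel i k ≡ true
open Partition public

SamePartition : ∀ {m} → Partition m → Partition m → Set
SamePartition π σ = ∀ i j → rel π i j ≡ rel σ i j

HasCard : ∀ {a b} (A : Set a) → (A → A → Set b) → ℕ → Set (a ⊔ b)
HasCard A _~_ k =
  Σ (Fin k → A) λ v → (∀ i j → v i ~ v j → i ≡ j) × (∀ x → ∃ λ i → v i ~ x)

module Geometry {c ℓ₁ ℓ₂} (F : OrderedField c ℓ₁ ℓ₂) where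
  open OrderedField F

  Point : Set c
  Point = Carrier × Carrier

  _≈ₚ_ : Point → Point → Set ℓ₁
  p ≈ₚ q = (proj₁ p ≈ proj₁ q) × (proj₂ p ≈ proj₂ q)

  origin : Point
  origin = 0# , 0#

  along : Point → Carrier → Point → Point
  along a t d = (proj₁ a + t * proj₁ d) , (proj₂ a + t * proj₂ d)

  sumF : ∀ {m} → (Fin m → Carrier) → Carrier
  sumF {ℕ.zero}  f = 0#
  sumF {ℕ.suc m} f = f Fin.zero + sumF (λ i → f (Fin.suc i))

  InHull : ∀ {m} → (Fin m → Point) → (Fin m → Bool) → Point → Set (c ⊔ ℓ₁ ⊔ ℓ₂)
  InHull pt S p =
    Σ (_ → Carrier) λ w →
      (∀ k → 0# ≤ w k) ×
      (∀ k → S k ≡ false → w k ≈ 0#) ×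
      (sumF w ≈ 1#) ×
      (sumF (λ k → w k * proj₁ (pt k)) ≈ proj₁ p) ×
      (sumF (λ k → w k * proj₂ (pt k)) ≈ proj₂ p)

  NonCrossing : ∀ {m} → (Fin m → Point) → Partition m → Set (c ⊔ ℓ₁ ⊔ ℓ₂)
  NonCrossing pt π =
    ∀ i j → rel π i j ≡ false →
      ¬ (∃ λ p → InHull pt (rel π i) p × InHull pt (rel π j) p)

  record Config (n : ℕ) : Set (c ⊔ ℓ₁) where
    field
      xs       : Fin n → Point
      y        : Point
      distinct : ∀ i j → xs i ≈ₚ xs j → i ≡ j
      line     : ∃ λ a → ∃ λ d → ¬ (d ≈ₚ origin) ×
                   (∀ i → ∃ λ t → xs i ≈ₚ along a t d) ×
                   (∀ t → ¬ (y ≈ₚ along a t d))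

  points : ∀ {n} → Config n → Fin (ℕ.suc n) → Point
  points T Fin.zero    = Config.y T
  points T (Fin.suc i) = Config.xs T i

  NC : ∀ {n} → Config n → Set (c ⊔ ℓ₁ ⊔ ℓ₂)
  NC {n} T = Σ (Partition (ℕ.suc n)) (NonCrossing (points T))

  _~NC_ : ∀ {n} {T : Config n} → NC T → NC T → Set
  a ~NC b = SamePartition (proj₁ a) (proj₁ b)

Series : Set
Series = ℕ → ℤ

private
  convSum : ℕ → (ℕ → ℤ) → ℤ
  convSum ℕ.zero    h = h 0
  convSum (ℕ.suc k) h = h (ℕ.suc k) ℤ.+ convSum k h

_⋆_ : Series → Series → Series
(f ⋆ g) n = convSum n (λ k → f k ℤ.* g (n ℕ.∸ k))

_⊖ₛ_ : Series → Series → Series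
(f ⊖ₛ g) n = f n ℤ.- g n

_·ₛ_ : ℤ → Series → Series
(a ·ₛ f) n = a ℤ.* f n

oneₛ : Series
oneₛ ℕ.zero = ℤ.+ 1
oneₛ (ℕ.suc _) = ℤ.+ 0

Xₛ : Series
Xₛ 1 = ℤ.+ 1
Xₛ _ = ℤ.+ 0

gf : (ℕ → ℕ) → Series
gf t n = ℤ.+ (t n)

{-# OPTIONS --safe #-}

-- Sort x₁,…,xₙ along their line. A partition of Tₙ is noncrossing iff every block meets
-- {x₁,…,xₙ} in an interval: a point between two points of a block lies in the block's hull,
-- and conversely two blocks whose intervals are disjoint are strictly separated by a line
-- through y and a point of the line lying between them. Such partitions are counted by the
-- fate of x₁: it is a singleton, joins x₂, or joins y while the rest keeps y alone. With qₙ
-- the number having y alone, q_{m+2} = 2q_{m+1} and t_{m+2} = 2t_{m+1} + q_{m+1}, so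
-- t_{m+3} = 4t_{m+2} - 4t_{m+1}, which is (1 - 2x)² Σ tₙxⁿ = (1 - x)².
module Submission where

open import Defs
open import Data.Nat using (ℕ)
open import Data.Integer using (+_)
open import Data.Product using (Σ; _×_; _,_)
open import Relation.Binary.PropositionalEquality using (_≡_)
open import Algebra.Bundles using (CommutativeRing)
open import Relation.Binary.Bundles using (TotalOrder)

-- Algebra.Solver.Ring with integer coefficients, so that identities whose normal forms need
-- coefficient cancellation, such as (y - x) + x = y, are decided in any commutative ring.
module IntegerCoefficientSolver {c ℓ} (R : CommutativeRing c ℓ) where
  open import Data.Nat as ℕ using (ℕ; zero; suc)
  open import Data.Integer as ℤ using (ℤ; +_; -[1+_]; _⊖_)
  import Data.Integer.Properties as ℤ
  import Data.Nat.Properties as ℕ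
  open import Data.Maybe using (Maybe; just; nothing)
  open import Relation.Binary.PropositionalEquality as ≡ using (_≡_)
  open import Relation.Nullary using (yes; no)
  import Algebra.Solver.Ring.AlmostCommutativeRing as ACR
  open CommutativeRing R
  open import Algebra.Properties.Ring ring using (-‿involutive; -0#≈0#; -‿+-comm; -‿distribˡ-*; -‿distribʳ-*)
  open import Algebra.Properties.Semiring.Mult semiring using (×-homo-+; ×1-homo-*) renaming (_×_ to _×ₙ_)
  open import Relation.Binary.Reasoning.Setoid setoid

  fromℤ : ℤ → Carrier
  fromℤ (+ n)      = n ×ₙ 1#
  fromℤ (-[1+ n ]) = - (suc n ×ₙ 1#)

  -‿homo : ∀ i → fromℤ (ℤ.- i) ≈ - fromℤ i
  -‿homo (+ zero)  = sym -0#≈0#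
  -‿homo (+ suc n) = refl
  -‿homo -[1+ n ]  = sym (-‿involutive _)

  ⊖-homo : ∀ m n → fromℤ (m ⊖ n) ≈ m ×ₙ 1# - n ×ₙ 1#
  ⊖-homo m zero = begin
    m ×ₙ 1#       ≈⟨ +-identityʳ _ ⟨
    m ×ₙ 1# + 0#  ≈⟨ +-congˡ -0#≈0# ⟨
    m ×ₙ 1# - 0#  ∎
  ⊖-homo zero (suc n) = begin
    fromℤ (0 ⊖ suc n)  ≡⟨ ≡.cong fromℤ (ℤ.⊖-< {0} {suc n} (ℕ.s≤s ℕ.z≤n)) ⟩
    - (suc n ×ₙ 1#)    ≈⟨ +-identityˡ _ ⟨
    0# - suc n ×ₙ 1#   ∎
  ⊖-homo (suc m) (suc n) = begin
    fromℤ (suc m ⊖ suc n)              ≡⟨ ≡.cong fromℤ (ℤ.[1+m]⊖[1+n]≡m⊖n m n) ⟩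
    fromℤ (m ⊖ n)                      ≈⟨ ⊖-homo m n ⟩
    m ×ₙ 1# - n ×ₙ 1#                  ≈⟨ +-congʳ (+-identityˡ _) ⟨
    (0# + m ×ₙ 1#) - n ×ₙ 1#           ≈⟨ +-congʳ (+-congʳ (-‿inverseʳ 1#)) ⟨
    ((1# - 1#) + m ×ₙ 1#) - n ×ₙ 1#    ≈⟨ +-congʳ (+-assoc _ _ _) ⟩
    (1# + (- 1# + m ×ₙ 1#)) - n ×ₙ 1#  ≈⟨ +-congʳ (+-congˡ (+-comm _ _)) ⟩
    (1# + (m ×ₙ 1# - 1#)) - n ×ₙ 1#    ≈⟨ +-congʳ (+-assoc _ _ _) ⟨
    (suc m ×ₙ 1# - 1#) - n ×ₙ 1#       ≈⟨ +-assoc _ _ _ ⟩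
    suc m ×ₙ 1# + (- 1# - n ×ₙ 1#)     ≈⟨ +-congˡ (-‿+-comm _ _) ⟩
    suc m ×ₙ 1# - suc n ×ₙ 1#          ∎

  +-homo : ∀ i j → fromℤ (i ℤ.+ j) ≈ fromℤ i + fromℤ j
  +-homo (+ m)    (+ n)    = ×-homo-+ 1# m n
  +-homo (+ m)    -[1+ n ] = ⊖-homo m (suc n)
  +-homo -[1+ m ] (+ n)    = trans (⊖-homo n (suc m)) (+-comm _ _)
  +-homo -[1+ m ] -[1+ n ] = begin
    - (suc (suc (m ℕ.+ n)) ×ₙ 1#)      ≡⟨ ≡.cong (λ k → - (k ×ₙ 1#)) (ℕ.+-suc (suc m) n) ⟨
    - ((suc m ℕ.+ suc n) ×ₙ 1#)        ≈⟨ -‿cong (×-homo-+ 1# (suc m) (suc n)) ⟩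
    - (suc m ×ₙ 1# + suc n ×ₙ 1#)      ≈⟨ -‿+-comm _ _ ⟨
    - (suc m ×ₙ 1#) + - (suc n ×ₙ 1#)  ∎

  *-homo⁺ : ∀ m j → fromℤ (+ m ℤ.* j) ≈ fromℤ (+ m) * fromℤ j
  *-homo⁺ m (+ n) = trans (reflexive (≡.cong fromℤ (≡.sym (ℤ.pos-* m n)))) (×1-homo-* m n)
  *-homo⁺ m -[1+ n ] = begin
    fromℤ (+ m ℤ.* ℤ.- + suc n)        ≡⟨ ≡.cong fromℤ (ℤ.neg-distribʳ-* (+ m) (+ suc n)) ⟨
    fromℤ (ℤ.- (+ m ℤ.* + suc n))      ≈⟨ -‿homo (+ m ℤ.* + suc n) ⟩
    - fromℤ (+ m ℤ.* + suc n)          ≈⟨ -‿cong (*-homo⁺ m (+ suc n)) ⟩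
    - (fromℤ (+ m) * fromℤ (+ suc n))  ≈⟨ -‿distribʳ-* _ _ ⟩
    fromℤ (+ m) * - fromℤ (+ suc n)    ∎

  *-homo : ∀ i j → fromℤ (i ℤ.* j) ≈ fromℤ i * fromℤ j
  *-homo (+ m)    j = *-homo⁺ m j
  *-homo -[1+ m ] j = begin
    fromℤ (ℤ.- + suc m ℤ.* j)      ≡⟨ ≡.cong fromℤ (ℤ.neg-distribˡ-* (+ suc m) j) ⟨
    fromℤ (ℤ.- (+ suc m ℤ.* j))    ≈⟨ -‿homo (+ suc m ℤ.* j) ⟩
    - fromℤ (+ suc m ℤ.* j)        ≈⟨ -‿cong (*-homo⁺ (suc m) j) ⟩
    - (fromℤ (+ suc m) * fromℤ j)  ≈⟨ -‿distribˡ-* _ _ ⟩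
    - fromℤ (+ suc m) * fromℤ j    ∎

  coefficients⟶R : ℤ.+-*-rawRing ACR.-Raw-AlmostCommutative⟶ ACR.fromCommutativeRing R
  coefficients⟶R = record
    { ⟦_⟧ = fromℤ ; +-homo = +-homo ; *-homo = *-homo ; -‿homo = -‿homo
    ; 0-homo = refl ; 1-homo = +-identityʳ 1# }

  ≟-coefficient : ∀ i j → Maybe (fromℤ i ≈ fromℤ j)
  ≟-coefficient i j with i ℤ.≟ j
  ... | yes ≡.refl = just refl
  ... | no _       = nothing

  open import Algebra.Solver.Ring ℤ.+-*-rawRing (ACR.fromCommutativeRing R) coefficients⟶R ≟-coefficient public

module OrderedFieldProperties {c ℓ₁ ℓ₂} (F : OrderedField c ℓ₁ ℓ₂) where
  open import Data.Product using (∃; ∃₂; _×_; _,_)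
  open import Data.Sum using (inj₁; inj₂)
  open import Relation.Nullary using (¬_; contradiction)
  open import Relation.Binary.Bundles using (TotalOrder)
  open OrderedField F hiding (_≤_)
  open IntegerCoefficientSolver commRing using (solve; _:+_; _:*_; _:-_; :-_; _:=_)
  open import Algebra.Properties.Ring ring using (-‿involutive; -0#≈0#; -‿distribˡ-*)

  totalOrder : TotalOrder c ℓ₁ ℓ₂
  totalOrder = record { isTotalOrder = OrderedField.isTotalOrder F }

  open TotalOrder totalOrder public
    using (_≤_; total; antisym; poset; ≤-respˡ-≈; ≤-respʳ-≈)
    renaming (refl to ≤-refl; trans to ≤-trans; reflexive to ≤-reflexive)
  open import Relation.Binary.Properties.Poset poset public
    using (_<_; ≤∧≉⇒<)
  open import Relation.Binary.Reasoning.PartialOrder poset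

  +-monoʳ-≤ : ∀ z {x y} → x ≤ y → z + x ≤ z + y
  +-monoʳ-≤ z {x} {y} x≤y = begin
    z + x  ≈⟨ +-comm z x ⟩
    x + z  ≤⟨ +-monoˡ-≤ z x≤y ⟩
    y + z  ≈⟨ +-comm y z ⟩
    z + y  ∎

  +-mono-≤ : ∀ {x y u v} → x ≤ y → u ≤ v → x + u ≤ y + v
  +-mono-≤ {y = y} {u} x≤y u≤v = ≤-trans (+-monoˡ-≤ u x≤y) (+-monoʳ-≤ y u≤v)

  +-nonNeg : ∀ {x y} → 0# ≤ x → 0# ≤ y → 0# ≤ x + y
  +-nonNeg 0≤x 0≤y = ≤-respˡ-≈ (+-identityʳ 0#) (+-mono-≤ 0≤x 0≤y)

  x≤y⇒0≤y-x : ∀ {x y} → x ≤ y → 0# ≤ y - x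
  x≤y⇒0≤y-x {x} {y} x≤y = begin
    0#     ≈⟨ -‿inverseʳ x ⟨
    x - x  ≤⟨ +-monoˡ-≤ (- x) x≤y ⟩
    y - x  ∎

  0≤y-x⇒x≤y : ∀ {x y} → 0# ≤ y - x → x ≤ y
  0≤y-x⇒x≤y {x} {y} 0≤y-x = begin
    x            ≈⟨ +-identityˡ x ⟨
    0# + x       ≤⟨ +-monoˡ-≤ x 0≤y-x ⟩
    (y - x) + x  ≈⟨ solve 2 (λ x y → (y :- x) :+ x := y) refl x y ⟩
    y            ∎

  y-x≈0⇒y≈x : ∀ {x y} → y - x ≈ 0# → y ≈ x
  y-x≈0⇒y≈x {x} {y} y-x≈0 = begin-equality
    y            ≈⟨ solve 2 (λ x y → y := (y :- x) :+ x) refl x y ⟩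
    (y - x) + x  ≈⟨ +-congʳ y-x≈0 ⟩
    0# + x       ≈⟨ +-identityˡ x ⟩
    x            ∎

  neg-antimono-≤ : ∀ {x y} → x ≤ y → - y ≤ - x
  neg-antimono-≤ {x} {y} x≤y = 0≤y-x⇒x≤y (≤-respʳ-≈
    (solve 2 (λ x y → y :- x := (:- x) :- (:- y)) refl x y) (x≤y⇒0≤y-x x≤y))

  nonPos⇒0≤neg : ∀ {x} → x ≤ 0# → 0# ≤ - x
  nonPos⇒0≤neg x≤0 = ≤-respˡ-≈ -0#≈0# (neg-antimono-≤ x≤0)

  *-monoʳ-≤-nonNeg : ∀ {z} → 0# ≤ z → ∀ {x y} → x ≤ y → x * z ≤ y * z
  *-monoʳ-≤-nonNeg {z} 0≤z {x} {y} x≤y = 0≤y-x⇒x≤y (≤-respʳ-≈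
    (solve 3 (λ x y z → (y :- x) :* z := y :* z :- x :* z) refl x y z)
    (0≤* (x≤y⇒0≤y-x x≤y) 0≤z))

  *-monoʳ-≤-nonPos : ∀ {z} → z ≤ 0# → ∀ {x y} → x ≤ y → y * z ≤ x * z
  *-monoʳ-≤-nonPos {z} z≤0 {x} {y} x≤y = 0≤y-x⇒x≤y (≤-respʳ-≈
    (solve 3 (λ x y z → (y :- x) :* (:- z) := x :* z :- y :* z) refl x y z)
    (0≤* (x≤y⇒0≤y-x x≤y) (nonPos⇒0≤neg z≤0)))

  1≰0 : ¬ (1# ≤ 0#)
  1≰0 1≤0 = 0≉1 (antisym 0≤1 1≤0)
    where
    0≤1 : 0# ≤ 1#
    0≤1 = ≤-respʳ-≈ (trans (sym (-‿distribˡ-* 1# (- 1#))) (trans (-‿cong (*-identityˡ _)) (-‿involutive 1#)))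
            (0≤* (nonPos⇒0≤neg 1≤0) (nonPos⇒0≤neg 1≤0))

  0≤1 : 0# ≤ 1#
  0≤1 with total 0# 1#
  ... | inj₁ 0≤1 = 0≤1
  ... | inj₂ 1≤0 = contradiction 1≤0 1≰0

  x-1<x : ∀ x → x - 1# < x
  x-1<x x = 0≤y-x⇒x≤y (≤-respʳ-≈ (sym x-[x-1]≈1) 0≤1) , λ x-1≈x → 0≉1 (begin-equality
    0#            ≈⟨ -‿inverseʳ x ⟨
    x - x         ≈⟨ +-congˡ (-‿cong x-1≈x) ⟨
    x - (x - 1#)  ≈⟨ x-[x-1]≈1 ⟩
    1#            ∎)
    where
    x-[x-1]≈1 : x - (x - 1#) ≈ 1#
    x-[x-1]≈1 = solve 2 (λ x o → x :- (x :- o) := o) refl x 1#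

  x≉0∧y≉0⇒x*y≉0 : ∀ {x y} → ¬ (x ≈ 0#) → ¬ (y ≈ 0#) → ¬ (x * y ≈ 0#)
  x≉0∧y≉0⇒x*y≉0 {x} {y} x≉0 y≉0 xy≈0 with inverse x x≉0
  ... | x⁻¹ , xx⁻¹≈1 = y≉0 (begin-equality
    y              ≈⟨ *-identityˡ y ⟨
    1# * y         ≈⟨ *-congʳ xx⁻¹≈1 ⟨
    (x * x⁻¹) * y  ≈⟨ solve 3 (λ x r y → (x :* r) :* y := r :* (x :* y)) refl x x⁻¹ y ⟩
    x⁻¹ * (x * y)  ≈⟨ *-congˡ xy≈0 ⟩
    x⁻¹ * 0#       ≈⟨ zeroʳ x⁻¹ ⟩
    0#             ∎)

  inverse-nonNeg : ∀ {x r} → 0# ≤ x → x * r ≈ 1# → 0# ≤ r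
  inverse-nonNeg {x} {r} 0≤x xr≈1 with total 0# r
  ... | inj₁ 0≤r = 0≤r
  ... | inj₂ r≤0 = contradiction (≤-respˡ-≈ xr≈1 (≤-respʳ-≈ (zeroˡ r) (*-monoʳ-≤-nonPos r≤0 0≤x))) 1≰0

  parallel⇒multiple : ∀ {e₁ e₂ d₁ d₂} → ¬ (d₁ ≈ 0#) → e₁ * d₂ ≈ e₂ * d₁ →
                      ∃ λ r → e₁ ≈ r * d₁ × e₂ ≈ r * d₂
  parallel⇒multiple {e₁} {e₂} {d₁} {d₂} d₁≉0 e₁d₂≈e₂d₁ with inverse d₁ d₁≉0
  ... | d₁⁻¹ , d₁d₁⁻¹≈1 = e₁ * d₁⁻¹ , e₁≈ , e₂≈
    where
    e₁≈ : e₁ ≈ (e₁ * d₁⁻¹) * d₁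
    e₁≈ = begin-equality
      e₁                ≈⟨ *-identityʳ e₁ ⟨
      e₁ * 1#           ≈⟨ *-congˡ d₁d₁⁻¹≈1 ⟨
      e₁ * (d₁ * d₁⁻¹)  ≈⟨ solve 3 (λ e d r → e :* (d :* r) := (e :* r) :* d) refl e₁ d₁ d₁⁻¹ ⟩
      (e₁ * d₁⁻¹) * d₁  ∎
    e₂≈ : e₂ ≈ (e₁ * d₁⁻¹) * d₂
    e₂≈ = begin-equality
      e₂                ≈⟨ *-identityʳ e₂ ⟨
      e₂ * 1#           ≈⟨ *-congˡ d₁d₁⁻¹≈1 ⟨
      e₂ * (d₁ * d₁⁻¹)  ≈⟨ *-assoc e₂ d₁ d₁⁻¹ ⟨
      (e₂ * d₁) * d₁⁻¹  ≈⟨ *-congʳ e₁d₂≈e₂d₁ ⟨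
      (e₁ * d₂) * d₁⁻¹  ≈⟨ solve 3 (λ e d r → (e :* d) :* r := (e :* r) :* d) refl e₁ d₂ d₁⁻¹ ⟩
      (e₁ * d₁⁻¹) * d₂  ∎

  between⇒convex-combination : ∀ {tᵢ t tⱼ} → tᵢ < t → t < tⱼ →
    ∃₂ λ λᵢ λⱼ → 0# ≤ λᵢ × 0# ≤ λⱼ × λᵢ + λⱼ ≈ 1# ×
                 (∀ A D → λᵢ * (A + tᵢ * D) + λⱼ * (A + tⱼ * D) ≈ A + t * D)
  between⇒convex-combination {tᵢ} {t} {tⱼ} (tᵢ≤t , tᵢ≉t) (t≤tⱼ , _)
    with inverse (tⱼ - tᵢ) (λ tⱼ-tᵢ≈0 → tᵢ≉t (antisym tᵢ≤t (≤-trans t≤tⱼ (≤-reflexive (y-x≈0⇒y≈x tⱼ-tᵢ≈0)))))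
  ... | r , [tⱼ-tᵢ]r≈1 =
    (tⱼ - t) * r , (t - tᵢ) * r , 0≤* (x≤y⇒0≤y-x t≤tⱼ) 0≤r , 0≤* (x≤y⇒0≤y-x tᵢ≤t) 0≤r , weights-sum , combination
    where
    0≤r : 0# ≤ r
    0≤r = inverse-nonNeg (x≤y⇒0≤y-x (≤-trans tᵢ≤t t≤tⱼ)) [tⱼ-tᵢ]r≈1
    weights-sum : (tⱼ - t) * r + (t - tᵢ) * r ≈ 1#
    weights-sum = trans (solve 4 (λ tᵢ t tⱼ r → (tⱼ :- t) :* r :+ (t :- tᵢ) :* r := (tⱼ :- tᵢ) :* r) refl tᵢ t tⱼ r)
                        [tⱼ-tᵢ]r≈1
    combination : ∀ A D → (tⱼ - t) * r * (A + tᵢ * D) + (t - tᵢ) * r * (A + tⱼ * D) ≈ A + t * D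
    combination A D = begin-equality
      (tⱼ - t) * r * (A + tᵢ * D) + (t - tᵢ) * r * (A + tⱼ * D)
        ≈⟨ solve 6 (λ tᵢ t tⱼ r A D → (tⱼ :- t) :* r :* (A :+ tᵢ :* D) :+ (t :- tᵢ) :* r :* (A :+ tⱼ :* D)
                                       := ((tⱼ :- tᵢ) :* r) :* (A :+ t :* D)) refl tᵢ t tⱼ r A D ⟩
      ((tⱼ - tᵢ) * r) * (A + t * D)  ≈⟨ *-congʳ [tⱼ-tᵢ]r≈1 ⟩
      1# * (A + t * D)               ≈⟨ *-identityˡ _ ⟩
      A + t * D                      ∎

module ConvexHulls {c ℓ₁ ℓ₂} (F : OrderedField c ℓ₁ ℓ₂) where
  open import Data.Nat using (ℕ; zero; suc)
  open import Data.Fin using (Fin; zero; suc)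
  open import Data.Bool using (Bool; true; false)
  open import Data.Product using (∃; _×_; _,_; proj₁; proj₂)
  open import Relation.Binary.PropositionalEquality as ≡ using (_≡_; _≢_)
  open import Relation.Nullary using (¬_; contradiction)
  open OrderedField F hiding (_≤_; zero)
  open OrderedFieldProperties F
  open IntegerCoefficientSolver commRing using (solve; _:+_; _:*_; :-_; _:=_)
  open Geometry F
  open import Relation.Binary.Reasoning.Setoid setoid

  private variable m : ℕ

  sumF-cong : {f g : Fin m → Carrier} → (∀ k → f k ≈ g k) → sumF f ≈ sumF g
  sumF-cong {zero}  f≈g = refl
  sumF-cong {suc m} f≈g = +-cong (f≈g zero) (sumF-cong (λ k → f≈g (suc k)))

  sumF-+ : (f g : Fin m → Carrier) → sumF (λ k → f k + g k) ≈ sumF f + sumF g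
  sumF-+ {zero}  f g = sym (+-identityˡ 0#)
  sumF-+ {suc m} f g = trans (+-congˡ (sumF-+ (λ k → f (suc k)) (λ k → g (suc k))))
    (solve 4 (λ a b c d → (a :+ b) :+ (c :+ d) := (a :+ c) :+ (b :+ d)) refl (f zero) (g zero) _ _)

  sumF-*ˡ : ∀ a (f : Fin m → Carrier) → sumF (λ k → a * f k) ≈ a * sumF f
  sumF-*ˡ {zero}  a f = sym (zeroʳ a)
  sumF-*ˡ {suc m} a f = trans (+-congˡ (sumF-*ˡ a (λ k → f (suc k)))) (sym (distribˡ a _ _))

  sumF-mono-≤ : {f g : Fin m → Carrier} → (∀ k → f k ≤ g k) → sumF f ≤ sumF g
  sumF-mono-≤ {zero}  f≤g = ≤-refl
  sumF-mono-≤ {suc m} f≤g = +-mono-≤ (f≤g zero) (sumF-mono-≤ (λ k → f≤g (suc k)))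

  sumF-zero : (f : Fin m → Carrier) → (∀ k → f k ≈ 0#) → sumF f ≈ 0#
  sumF-zero {zero}  f f≈0 = refl
  sumF-zero {suc m} f f≈0 = trans (+-cong (f≈0 zero) (sumF-zero _ (λ k → f≈0 (suc k)))) (+-identityˡ 0#)

  δ : Fin m → Fin m → Carrier
  δ zero    zero    = 1#
  δ zero    (suc _) = 0#
  δ (suc _) zero    = 0#
  δ (suc a) (suc b) = δ a b

  δ-nonNeg : (a b : Fin m) → 0# ≤ δ a b
  δ-nonNeg zero    zero    = 0≤1
  δ-nonNeg zero    (suc _) = ≤-refl
  δ-nonNeg (suc _) zero    = ≤-refl
  δ-nonNeg (suc a) (suc b) = δ-nonNeg a b

  δ-off : {a b : Fin m} → a ≢ b → δ a b ≈ 0#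
  δ-off {a = zero}  {zero}  a≢b = contradiction ≡.refl a≢b
  δ-off {a = zero}  {suc _} a≢b = refl
  δ-off {a = suc _} {zero}  a≢b = refl
  δ-off {a = suc a} {suc b} a≢b = δ-off (λ a≡b → a≢b (≡.cong suc a≡b))

  sumF-δ : (a : Fin m) (g : Fin m → Carrier) → sumF (λ k → δ a k * g k) ≈ g a
  sumF-δ zero g = trans (+-cong (*-identityˡ (g zero)) (sumF-zero _ (λ k → zeroˡ (g (suc k))))) (+-identityʳ _)
  sumF-δ (suc a) g = trans (+-congʳ (zeroˡ (g zero))) (trans (+-identityˡ _) (sumF-δ a (λ k → g (suc k))))

  δ-outside : (S : Fin m → Bool) (a k : Fin m) → S a ≡ true → S k ≡ false → δ a k ≈ 0#
  δ-outside S a k Sa Sk = δ-off {a = a} {k} λ { ≡.refl → contradiction (≡.trans (≡.sym Sa) Sk) λ () }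

  sumF-δ-pair : (i j : Fin m) (λᵢ λⱼ : Carrier) (g : Fin m → Carrier) →
                sumF (λ k → (δ i k * λᵢ + δ j k * λⱼ) * g k) ≈ λᵢ * g i + λⱼ * g j
  sumF-δ-pair i j λᵢ λⱼ g = begin
    sumF (λ k → (δ i k * λᵢ + δ j k * λⱼ) * g k)
      ≈⟨ sumF-cong (λ k → solve 5 (λ p q x y z → (p :* x :+ q :* y) :* z := p :* (x :* z) :+ q :* (y :* z))
                                  refl (δ i k) (δ j k) λᵢ λⱼ (g k)) ⟩
    sumF (λ k → δ i k * (λᵢ * g k) + δ j k * (λⱼ * g k))
      ≈⟨ sumF-+ (λ k → δ i k * (λᵢ * g k)) (λ k → δ j k * (λⱼ * g k)) ⟩
    sumF (λ k → δ i k * (λᵢ * g k)) + sumF (λ k → δ j k * (λⱼ * g k))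
      ≈⟨ +-cong (sumF-δ i (λ k → λᵢ * g k)) (sumF-δ j (λ k → λⱼ * g k)) ⟩
    λᵢ * g i + λⱼ * g j ∎

  segment⊆hull : (pt : Fin m → Point) {S : Fin m → Bool} {i j : Fin m} → S i ≡ true → S j ≡ true →
                 ∀ {λᵢ λⱼ} → 0# ≤ λᵢ → 0# ≤ λⱼ → λᵢ + λⱼ ≈ 1# → ∀ p →
                 λᵢ * proj₁ (pt i) + λⱼ * proj₁ (pt j) ≈ proj₁ p →
                 λᵢ * proj₂ (pt i) + λⱼ * proj₂ (pt j) ≈ proj₂ p →
                 InHull pt S p
  segment⊆hull pt {S} {i} {j} Si Sj {λᵢ} {λⱼ} 0≤λᵢ 0≤λⱼ λᵢ+λⱼ≈1 p p₁ p₂ =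
    w , w-nonNeg , w-outside ,
    trans (sumF-cong (λ k → sym (*-identityʳ (w k)))) (trans (sumF-δ-pair i j λᵢ λⱼ (λ _ → 1#)) sum-λ≈1) ,
    trans (sumF-δ-pair i j λᵢ λⱼ (λ k → proj₁ (pt k))) p₁ ,
    trans (sumF-δ-pair i j λᵢ λⱼ (λ k → proj₂ (pt k))) p₂
    where
    w : Fin _ → Carrier
    w k = δ i k * λᵢ + δ j k * λⱼ
    w-nonNeg : ∀ k → 0# ≤ w k
    w-nonNeg k = +-nonNeg (0≤* (δ-nonNeg i k) 0≤λᵢ) (0≤* (δ-nonNeg j k) 0≤λⱼ)
    w-outside : ∀ k → S k ≡ false → w k ≈ 0#
    w-outside k Sk = begin
      δ i k * λᵢ + δ j k * λⱼ  ≈⟨ +-cong (*-congʳ (δ-outside S i k Si Sk)) (*-congʳ (δ-outside S j k Sj Sk)) ⟩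
      0# * λᵢ + 0# * λⱼ        ≈⟨ +-cong (zeroˡ λᵢ) (zeroˡ λⱼ) ⟩
      0# + 0#                  ≈⟨ +-identityˡ 0# ⟩
      0#                       ∎
    sum-λ≈1 : λᵢ * 1# + λⱼ * 1# ≈ 1#
    sum-λ≈1 = trans (+-cong (*-identityʳ λᵢ) (*-identityʳ λⱼ)) λᵢ+λⱼ≈1

  vertex∈hull : (pt : Fin m → Point) {S : Fin m → Bool} {a : Fin m} → S a ≡ true → InHull pt S (pt a)
  vertex∈hull pt {S} {a} Sa = δ a , δ-nonNeg a , (λ k → δ-outside S a k Sa) , δ-sum , sumF-δ a _ , sumF-δ a _
    where
    δ-sum : sumF (δ a) ≈ 1#
    δ-sum = trans (sumF-cong (λ k → sym (*-identityʳ (δ a k)))) (sumF-δ a (λ _ → 1#))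

  φ : Carrier → Carrier → Point → Carrier
  φ α β q = α * proj₁ q + β * proj₂ q

  hull-≤ : (pt : Fin m → Point) {S : Fin m → Bool} {p : Point} (α β c′ : Carrier) → InHull pt S p →
           (∀ k → S k ≡ true → φ α β (pt k) ≤ c′) → φ α β p ≤ c′
  hull-≤ pt {S} {p} α β c′ (w , w≥0 , w-outside , Σw≈1 , Σwx≈p₁ , Σwy≈p₂) bounded =
    ≤-respˡ-≈ (sym φp≈Σwφ) (≤-respʳ-≈ Σwc≈c (sumF-mono-≤ termwise))
    where
    φp≈Σwφ : φ α β p ≈ sumF (λ k → w k * φ α β (pt k))
    φp≈Σwφ = begin
      α * proj₁ p + β * proj₂ p
        ≈⟨ +-cong (*-congˡ (sym Σwx≈p₁)) (*-congˡ (sym Σwy≈p₂)) ⟩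
      α * sumF (λ k → w k * proj₁ (pt k)) + β * sumF (λ k → w k * proj₂ (pt k))
        ≈⟨ +-cong (sym (sumF-*ˡ α (λ k → w k * proj₁ (pt k)))) (sym (sumF-*ˡ β (λ k → w k * proj₂ (pt k)))) ⟩
      sumF (λ k → α * (w k * proj₁ (pt k))) + sumF (λ k → β * (w k * proj₂ (pt k)))
        ≈⟨ sym (sumF-+ (λ k → α * (w k * proj₁ (pt k))) (λ k → β * (w k * proj₂ (pt k)))) ⟩
      sumF (λ k → α * (w k * proj₁ (pt k)) + β * (w k * proj₂ (pt k)))
        ≈⟨ sumF-cong (λ k → solve 5 (λ a b w x y → a :* (w :* x) :+ b :* (w :* y) := w :* (a :* x :+ b :* y))
                                    refl α β (w k) (proj₁ (pt k)) (proj₂ (pt k))) ⟩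
      sumF (λ k → w k * φ α β (pt k)) ∎
    Σwc≈c : sumF (λ k → w k * c′) ≈ c′
    Σwc≈c = begin
      sumF (λ k → w k * c′)  ≈⟨ sumF-cong (λ k → *-comm (w k) c′) ⟩
      sumF (λ k → c′ * w k)  ≈⟨ sumF-*ˡ c′ w ⟩
      c′ * sumF w            ≈⟨ *-congˡ Σw≈1 ⟩
      c′ * 1#                ≈⟨ *-identityʳ c′ ⟩
      c′                     ∎
    termwise : ∀ k → w k * φ α β (pt k) ≤ w k * c′
    termwise k with S k in Sk
    ... | true  = ≤-respˡ-≈ (*-comm _ _) (≤-respʳ-≈ (*-comm _ _) (*-monoʳ-≤-nonNeg (w≥0 k) (bounded k Sk)))
    ... | false = ≤-reflexive (trans (vanishes (φ α β (pt k))) (sym (vanishes c′)))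
      where
      vanishes : ∀ x → w k * x ≈ 0#
      vanishes x = trans (*-congʳ (w-outside k Sk)) (zeroˡ x)

  φ-neg : ∀ α β q → φ (- α) (- β) q ≈ - φ α β q
  φ-neg α β q = solve 4 (λ a b x y → (:- a) :* x :+ (:- b) :* y := :- (a :* x :+ b :* y)) refl α β (proj₁ q) (proj₂ q)

  hull-≥ : (pt : Fin m → Point) {S : Fin m → Bool} {p : Point} (α β c′ : Carrier) → InHull pt S p →
           (∀ k → S k ≡ true → c′ ≤ φ α β (pt k)) → c′ ≤ φ α β p
  hull-≥ pt {p = p} α β c′ p∈S bounded =
    ≤-respˡ-≈ (-‿involutive c′) (≤-respʳ-≈ (-‿involutive _) (neg-antimono-≤ (≤-respˡ-≈ (φ-neg α β p)
      (hull-≤ pt (- α) (- β) (- c′) p∈S λ k Sk → ≤-respˡ-≈ (sym (φ-neg α β (pt k))) (neg-antimono-≤ (bounded k Sk))))))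
    where open import Algebra.Properties.Ring ring using (-‿involutive)

  separated⇒disjoint-hulls : (pt : Fin m → Point) {S T : Fin m → Bool} (α β c₁ c₂ : Carrier) → c₁ < c₂ →
    (∀ k → S k ≡ true → φ α β (pt k) ≤ c₁) → (∀ k → T k ≡ true → c₂ ≤ φ α β (pt k)) →
    ¬ (∃ λ p → InHull pt S p × InHull pt T p)
  separated⇒disjoint-hulls pt α β c₁ c₂ (c₁≤c₂ , c₁≉c₂) S≤c₁ c₂≤T (p , p∈S , p∈T) =
    c₁≉c₂ (antisym c₁≤c₂ (≤-trans (hull-≥ pt α β c₂ p∈T c₂≤T) (hull-≤ pt α β c₁ p∈S S≤c₁)))

module FinOrder {a ℓ₁ ℓ₂} (O : TotalOrder a ℓ₁ ℓ₂) where
  open import Data.Nat using (zero; suc; s≤s)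
  open import Data.Fin as Fin using (Fin; zero; suc; punchIn)
  open import Data.Fin.Properties using (punchIn-injective; punchInᵢ≢i; <-cmp)
  open import Data.Fin.Permutation using (Permutation′; _⟨$⟩ʳ_; insert)
  import Data.Fin.Permutation as Permutation
  open import Data.Bool using (Bool; true; false)
  open import Data.Product using (Σ; ∃; _×_; _,_; proj₁; proj₂)
  open import Data.Sum using (_⊎_; inj₁; inj₂)
  open import Level using (_⊔_)
  open import Relation.Binary.Core using (Rel)
  open import Relation.Binary.Definitions using (Total; Transitive; Reflexive; tri<; tri≈; tri>)
  open import Relation.Binary.PropositionalEquality as ≡ using (_≡_)
  open import Relation.Nullary using (contradiction)
  open TotalOrder O
  open import Relation.Binary.Construct.NonStrictToStrict _≈_ _≤_ using (_<_; <⇒≱)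

  EmptyOrArgmax : ∀ {ℓ n} → Rel Carrier ℓ → (Fin n → Bool) → (Fin n → Carrier) → Set ℓ
  EmptyOrArgmax _≲_ S f = (∀ k → S k ≡ false) ⊎ (∃ λ k → S k ≡ true × (∀ l → S l ≡ true → f l ≲ f k))

  module _ {ℓ} {_≲_ : Rel Carrier ℓ} (≲-total : Total _≲_) (≲-trans : Transitive _≲_) (≲-refl : Reflexive _≲_) where

    argmax : ∀ {n} (S : Fin n → Bool) (f : Fin n → Carrier) → EmptyOrArgmax _≲_ S f
    argmax {zero} S f = inj₁ λ ()
    argmax {suc n} S f with argmax (λ k → S (suc k)) (λ k → f (suc k)) | S zero in S₀
    ... | inj₁ empty | false = inj₁ λ { zero → S₀ ; (suc k) → empty k }
    ... | inj₁ empty | true  = inj₂ (zero , S₀ , λ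
      { zero    _  → ≲-refl
      ; (suc l) Sl → contradiction (≡.trans (≡.sym Sl) (empty l)) λ () })
    ... | inj₂ (k , Sk , max) | false = inj₂ (suc k , Sk , λ
      { zero    Sl → contradiction (≡.trans (≡.sym Sl) S₀) λ ()
      ; (suc l) Sl → max l Sl })
    ... | inj₂ (k , Sk , max) | true with ≲-total (f zero) (f (suc k))
    ...   | inj₁ f₀≲ = inj₂ (suc k , Sk , λ { zero _ → f₀≲ ; (suc l) Sl → max l Sl })
    ...   | inj₂ ≲f₀ = inj₂ (zero , S₀ , λ { zero _ → ≲-refl ; (suc l) Sl → ≲-trans (max l Sl) ≲f₀ })

  maximum : ∀ {n} (S : Fin n → Bool) (f : Fin n → Carrier) → EmptyOrArgmax _≤_ S f
  maximum = argmax total trans refl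

  minimum : ∀ {n} (S : Fin n → Bool) (f : Fin n → Carrier) → EmptyOrArgmax _≥_ S f
  minimum = argmax (λ x y → total y x) (λ y≥x z≥y → trans z≥y y≥x) refl

  StrictlyIncreasing : ∀ {n} → (Fin n → Carrier) → Set (ℓ₁ ⊔ ℓ₂)
  StrictlyIncreasing g = ∀ {r s} → r Fin.< s → g r < g s

  sortingPermutation : ∀ {n} (f : Fin n → Carrier) → (∀ i j → f i ≈ f j → i ≡ j) →
                       Σ (Permutation′ n) λ σ → StrictlyIncreasing (λ r → f (σ ⟨$⟩ʳ r))
  sortingPermutation {zero} f f-inj = Permutation.id , λ { {()} }
  sortingPermutation {suc n} f f-inj with minimum (λ _ → true) f
  ... | inj₁ empty = contradiction (empty zero) λ ()
  ... | inj₂ (k₀ , _ , k₀-min) = insert zero k₀ ρ , increasing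
    where
    rest : Σ (Permutation′ n) λ ρ → StrictlyIncreasing (λ r → f (punchIn k₀ (ρ ⟨$⟩ʳ r)))
    rest = sortingPermutation (λ i → f (punchIn k₀ i)) (λ i j eq → punchIn-injective k₀ i j (f-inj _ _ eq))
    ρ : Permutation′ n
    ρ = proj₁ rest
    increasing : StrictlyIncreasing (λ r → f (insert zero k₀ ρ ⟨$⟩ʳ r))
    increasing {zero}  {suc s} _       = k₀-min _ ≡.refl , λ eq → punchInᵢ≢i k₀ (ρ ⟨$⟩ʳ s) (≡.sym (f-inj _ _ eq))
    increasing {suc r} {suc s} (s≤s r<s) = proj₂ rest r<s

  increasing⇒reflects-< : ∀ {n} {g : Fin n → Carrier} → StrictlyIncreasing g → ∀ {r s} → g r < g s → r Fin.< s
  increasing⇒reflects-< {g = g} g-inc {r} {s} gr<gs with <-cmp r s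
  ... | tri< r<s _ _ = r<s
  ... | tri≈ _ ≡.refl _ = contradiction Eq.refl (proj₂ gr<gs)
  ... | tri> _ _ s<r = contradiction (proj₁ gr<gs) (<⇒≱ antisym (g-inc s<r))

module Cardinality where
  open import Data.Nat using (_+_)
  open import Data.Fin using (Fin; splitAt; join)
  open import Data.Fin.Properties using (join-splitAt; splitAt-join)
  open import Data.Product using (∃; _,_; proj₁; proj₂)
  open import Data.Sum as Sum using (_⊎_; inj₁; inj₂)
  open import Data.Sum.Relation.Binary.Pointwise using (Pointwise; inj₁; inj₂)
  open import Relation.Binary.Core using (Rel)
  open import Relation.Binary.Definitions using (Transitive)
  open import Relation.Binary.PropositionalEquality as ≡ using (_≡_)

  HasCard-⊎ : ∀ {a b r s} {A : Set a} {B : Set b} {_~_ : Rel A r} {_≈_ : Rel B s} {k l} →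
              HasCard A _~_ k → HasCard B _≈_ l → HasCard (A ⊎ B) (Pointwise _~_ _≈_) (k + l)
  HasCard-⊎ {_~_ = _~_} {_≈_} {k} {l} (v , v-inj , v-surj) (w , w-inj , w-surj) = u , u-inj , u-surj
    where
    u : Fin (k + l) → _ ⊎ _
    u x = Sum.map v w (splitAt k x)
    u-split-inj : ∀ s t → Pointwise _~_ _≈_ (Sum.map v w s) (Sum.map v w t) → s ≡ t
    u-split-inj (inj₁ i) (inj₁ j) (inj₁ vi~vj) = ≡.cong inj₁ (v-inj i j vi~vj)
    u-split-inj (inj₂ i) (inj₂ j) (inj₂ wi≈wj) = ≡.cong inj₂ (w-inj i j wi≈wj)
    u-inj : ∀ x y → Pointwise _~_ _≈_ (u x) (u y) → x ≡ y
    u-inj x y ux~uy = begin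
      x                       ≡⟨ join-splitAt k l x ⟨
      join k l (splitAt k x)  ≡⟨ ≡.cong (join k l) (u-split-inj (splitAt k x) (splitAt k y) ux~uy) ⟩
      join k l (splitAt k y)  ≡⟨ join-splitAt k l y ⟩
      y                       ∎
      where open ≡.≡-Reasoning
    hit : ∀ s {z} → Pointwise _~_ _≈_ (Sum.map v w s) z → ∃ λ x → Pointwise _~_ _≈_ (u x) z
    hit s {z} r = join k l s , ≡.subst (λ t → Pointwise _~_ _≈_ (Sum.map v w t) z) (≡.sym (splitAt-join k l s)) r
    u-surj : ∀ z → ∃ λ x → Pointwise _~_ _≈_ (u x) z
    u-surj (inj₁ a) = hit (inj₁ (proj₁ (v-surj a))) (inj₁ (proj₂ (v-surj a)))
    u-surj (inj₂ b) = hit (inj₂ (proj₁ (w-surj b))) (inj₂ (proj₂ (w-surj b)))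

  HasCard-map : ∀ {a b r s} {A : Set a} {B : Set b} {_~_ : Rel A r} {_≈_ : Rel B s} {k}
                (f : A → B) → (∀ {x y} → x ~ y → f x ≈ f y) → (∀ x y → f x ≈ f y → x ~ y) →
                (∀ z → ∃ λ x → f x ≈ z) → Transitive _≈_ →
                HasCard A _~_ k → HasCard B _≈_ k
  HasCard-map f f-resp f-refl f-surj ≈-trans (v , v-inj , v-surj) =
    (λ i → f (v i)) , (λ i j fvi≈fvj → v-inj i j (f-refl _ _ fvi≈fvj)) ,
    λ z → let (x , fx≈z) = f-surj z ; (i , vi~x) = v-surj x in i , ≈-trans (f-resp vi~x) fx≈z

module Partitions where
  open import Level using (Level)
  open import Data.Nat using (ℕ; zero; suc)
  open import Data.Fin as Fin using (Fin; zero; suc)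
  open import Data.Bool using (Bool; true; false)
  open import Data.Product using (Σ; ∃; proj₁)
  open import Relation.Binary.PropositionalEquality as ≡ using (_≡_; _≢_)
  open import Data.Bool.Properties using (⇔→≡)
  open import Function.Bundles using (mk⇔)
  open import Relation.Nullary using (contradiction)
  open import Relation.Binary.Core using (Rel)
  open Cardinality using (HasCard-map)

  private variable
    m k n : ℕ
    ℓ : Level

  true≢false : ∀ {b} → b ≡ true → b ≢ false
  true≢false ≡.refl ()

  false-by-implication : ∀ {b c} → (b ≡ true → c ≡ true) → c ≡ false → b ≡ false
  false-by-implication {false} b⇒c c≡false = ≡.refl
  false-by-implication {true}  b⇒c c≡false = contradiction c≡false (true≢false (b⇒c ≡.refl))

  rel-sym : (π : Partition m) (a b : Fin m) → rel π a b ≡ rel π b a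
  rel-sym π a b = ⇔→≡ (mk⇔ (symP π a b) (symP π b a))

  rel-respʳ : (π : Partition m) {u v : Fin m} → rel π u v ≡ true → ∀ w → rel π w u ≡ rel π w v
  rel-respʳ π {u} {v} uv w = ⇔→≡ (mk⇔ (λ wu → transP π w u v wu uv) (λ wv → transP π w v u wv (symP π u v uv)))

  pullback : (Fin m → Fin k) → Partition k → Partition m
  pullback g π = record
    { rel    = λ a b → rel π (g a) (g b)
    ; reflP  = λ a → reflP π (g a)
    ; symP   = λ a b → symP π (g a) (g b)
    ; transP = λ a b c → transP π (g a) (g b) (g c)
    }

  pullback-resp : (g : Fin m → Fin k) (π σ : Partition k) → SamePartition π σ → SamePartition (pullback g π) (pullback g σ)
  pullback-resp g π σ π≋σ a b = π≋σ (g a) (g b)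

  pullback-cong : (π : Partition m) (g h : Fin k → Fin m) → (∀ a → g a ≡ h a) →
                  SamePartition (pullback g π) (pullback h π)
  pullback-cong π g h g≗h a b = ≡.cong₂ (rel π) (g≗h a) (g≗h b)

  pullback-injective : (g : Fin m → Fin k) (h : Fin k → Fin m) → (∀ a → g (h a) ≡ a) →
                       ∀ π σ → SamePartition (pullback g π) (pullback g σ) → SamePartition π σ
  pullback-injective g h g∘h≗id π σ gπ≋gσ a b = begin
    rel π a b                  ≡⟨ ≡.cong₂ (rel π) (g∘h≗id a) (g∘h≗id b) ⟨
    rel π (g (h a)) (g (h b))  ≡⟨ gπ≋gσ (h a) (h b) ⟩
    rel σ (g (h a)) (g (h b))  ≡⟨ ≡.cong₂ (rel σ) (g∘h≗id a) (g∘h≗id b) ⟩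
    rel σ a b                  ∎
    where open ≡.≡-Reasoning

  pullback-within-blocks : (π : Partition m) (g : Fin m → Fin m) → (∀ a → rel π a (g a) ≡ true) →
                           SamePartition (pullback g π) π
  pullback-within-blocks π g a~ga a b = begin
    rel π (g a) (g b)  ≡⟨ rel-sym π (g a) (g b) ⟩
    rel π (g b) (g a)  ≡⟨ rel-respʳ π (a~ga a) (g b) ⟨
    rel π (g b) a      ≡⟨ rel-sym π (g b) a ⟩
    rel π a (g b)      ≡⟨ rel-respʳ π (a~ga b) a ⟨
    rel π a b          ∎
    where open ≡.≡-Reasoning

  isolate : Partition m → Partition (suc m)
  isolate π = record { rel = r ; reflP = r-refl ; symP = r-sym ; transP = r-trans }
    where
    r : Fin (suc _) → Fin (suc _) → Bool
    r zero    zero    = true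
    r zero    (suc _) = false
    r (suc _) zero    = false
    r (suc a) (suc b) = rel π a b
    r-refl : ∀ a → r a a ≡ true
    r-refl zero    = ≡.refl
    r-refl (suc a) = reflP π a
    r-sym : ∀ a b → r a b ≡ true → r b a ≡ true
    r-sym zero    zero    ab = ab
    r-sym zero    (suc _) ()
    r-sym (suc _) zero    ()
    r-sym (suc a) (suc b) ab = symP π a b ab
    r-trans : ∀ a b c → r a b ≡ true → r b c ≡ true → r a c ≡ true
    r-trans zero    zero    c       ab bc = bc
    r-trans zero    (suc _) c       () bc
    r-trans (suc _) zero    c       () bc
    r-trans (suc _) (suc _) zero    ab ()
    r-trans (suc a) (suc b) (suc c) ab bc = transP π a b c ab bc

  isolate-resp : (π σ : Partition m) → SamePartition π σ → SamePartition (isolate π) (isolate σ)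
  isolate-resp π σ π≋σ zero    zero    = ≡.refl
  isolate-resp π σ π≋σ zero    (suc b) = ≡.refl
  isolate-resp π σ π≋σ (suc a) zero    = ≡.refl
  isolate-resp π σ π≋σ (suc a) (suc b) = π≋σ a b

  _≋_ : {P : Partition m → Set ℓ} → Σ (Partition m) P → Σ (Partition m) P → Set
  x ≋ y = SamePartition (proj₁ x) (proj₁ y)

  ≋-trans : {P : Partition m → Set ℓ} {x y z : Σ (Partition m) P} → x ≋ y → y ≋ z → x ≋ z
  ≋-trans x≋y y≋z a b = ≡.trans (x≋y a b) (y≋z a b)

  HasCard-map-≋ : ∀ {a r} {A : Set a} {_~_ : Rel A r} {P : Partition m → Set ℓ} {k} (f : A → Σ (Partition m) P) →
                  (∀ {x y} → x ~ y → f x ≋ f y) → (∀ x y → f x ≋ f y → x ~ y) → (∀ z → ∃ λ x → f x ≋ z) →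
                  HasCard A _~_ k → HasCard (Σ (Partition m) P) _≋_ k
  HasCard-map-≋ f f-resp f-refl f-surj = HasCard-map {_≈_ = _≋_} f f-resp f-refl f-surj (λ {x} {y} {z} → ≋-trans {x = x} {y} {z})

  -- Index 0 of Fin (suc n) is y and suc i is xᵢ: every block meets the xᵢ in a ≺-interval.
  IntervalBlocks : (Fin n → Fin n → Set ℓ) → Partition (suc n) → Set ℓ
  IntervalBlocks _≺_ π = ∀ i j k → i ≺ k → k ≺ j → rel π (suc i) (suc j) ≡ true → rel π (suc i) (suc k) ≡ true

  IntervalBlocks-pullback : {_≺_ : Fin n → Fin n → Set ℓ} {ℓ′ : Level} {_≺′_ : Fin m → Fin m → Set ℓ′}
    (σ : Fin m → Fin n) → (∀ {a b} → a ≺′ b → σ a ≺ σ b) →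
    {π : Partition (suc n)} → IntervalBlocks _≺_ π → IntervalBlocks _≺′_ (pullback (Fin.lift 1 σ) π)
  IntervalBlocks-pullback σ σ-mono intervals i j k i≺k k≺j = intervals (σ i) (σ j) (σ k) (σ-mono i≺k) (σ-mono k≺j)

module StandardIntervalPartitions where
  open import Data.Nat using (ℕ; zero; suc; _+_; _*_; s≤s; z≤n)
  open import Data.Fin as Fin using (Fin; zero; suc)
  open import Data.Bool using (true; false)
  open import Data.Product using (Σ; ∃; _×_; _,_; proj₁; proj₂)
  open import Data.Sum using (_⊎_; inj₁; inj₂; [_,_])
  open import Data.Sum.Relation.Binary.Pointwise using (Pointwise; inj₁; inj₂)
  open import Relation.Binary.PropositionalEquality as ≡ using (_≡_)
  open import Relation.Nullary using (¬_; contradiction)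
  open import Data.Empty using (⊥-elim)
  open Partitions
  open Cardinality

  private variable m : ℕ

  YAlone : Partition (suc m) → Set
  YAlone π = ∀ a → rel π zero (suc a) ≡ false

  IntervalPartition : ℕ → Set
  IntervalPartition n = Σ (Partition (suc n)) (IntervalBlocks Fin._<_)

  YAloneIntervalPartition : ℕ → Set
  YAloneIntervalPartition n = Σ (Partition (suc n)) (λ π → IntervalBlocks Fin._<_ π × YAlone π)

  -- The new point x₁ gets index 1 of Fin (2 + m); y keeps index 0 and the other points shift up by one.
  dropNew : Fin (suc m) → Fin (suc (suc m))
  dropNew = Fin.lift 1 suc

  restrict : Partition (suc (suc m)) → Partition (suc m)
  restrict = pullback dropNew

  mergeNewInto : Fin (suc m) → Fin (suc (suc m)) → Fin (suc m)
  mergeNewInto p zero          = zero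
  mergeNewInto p (suc zero)    = p
  mergeNewInto p (suc (suc a)) = suc a

  swap₀₁ : Fin (suc (suc m)) → Fin (suc (suc m))
  swap₀₁ zero          = suc zero
  swap₀₁ (suc zero)    = zero
  swap₀₁ (suc (suc a)) = suc (suc a)

  addSingleton : Partition (suc m) → Partition (suc (suc m))
  addSingleton π = pullback swap₀₁ (isolate π)

  addTo : Fin (suc m) → Partition (suc m) → Partition (suc (suc m))
  addTo p π = pullback (mergeNewInto p) π

  restrict-addSingleton : (π : Partition (suc m)) → SamePartition (restrict (addSingleton π)) π
  restrict-addSingleton π = pullback-cong (isolate π) (λ a → swap₀₁ (dropNew a)) suc λ { zero → ≡.refl ; (suc a) → ≡.refl }

  restrict-addTo : (p : Fin (suc m)) (π : Partition (suc m)) → SamePartition (restrict (addTo p π)) π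
  restrict-addTo p π = pullback-cong π (λ a → mergeNewInto p (dropNew a)) (λ a → a) λ { zero → ≡.refl ; (suc a) → ≡.refl }

  restrict-injective : (E : Partition (suc m) → Partition (suc (suc m))) → (∀ π → SamePartition (restrict (E π)) π) →
                       ∀ π σ → SamePartition (E π) (E σ) → SamePartition π σ
  restrict-injective E restrict∘E π σ Eπ≋Eσ a b =
    ≡.trans (≡.sym (restrict∘E π a b)) (≡.trans (Eπ≋Eσ (dropNew a) (dropNew b)) (restrict∘E σ a b))

  addSingleton-resp : (π σ : Partition (suc m)) → SamePartition π σ → SamePartition (addSingleton π) (addSingleton σ)
  addSingleton-resp π σ π≋σ = pullback-resp swap₀₁ (isolate π) (isolate σ) (isolate-resp π σ π≋σ)

  addTo-restrict : (p : Fin (suc m)) (π : Partition (suc (suc m))) → rel π (suc zero) (dropNew p) ≡ true →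
                   SamePartition (addTo p (restrict π)) π
  addTo-restrict p π 1~p = pullback-within-blocks π (λ a → dropNew (mergeNewInto p a)) λ
    { zero → reflP π zero ; (suc zero) → 1~p ; (suc (suc a)) → reflP π (suc (suc a)) }

  addSingleton-restrict : (π : Partition (suc (suc m))) → rel π (suc zero) zero ≡ false →
                          (∀ a → rel π (suc zero) (suc (suc a)) ≡ false) →
                          SamePartition (addSingleton (restrict π)) π
  addSingleton-restrict π 1≁0 1≁x zero          zero          = ≡.refl
  addSingleton-restrict π 1≁0 1≁x zero          (suc zero)    = ≡.sym (≡.trans (rel-sym π zero (suc zero)) 1≁0)
  addSingleton-restrict π 1≁0 1≁x zero          (suc (suc b)) = ≡.refl
  addSingleton-restrict π 1≁0 1≁x (suc zero)    zero          = ≡.sym 1≁0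
  addSingleton-restrict π 1≁0 1≁x (suc zero)    (suc zero)    = ≡.sym (reflP π (suc zero))
  addSingleton-restrict π 1≁0 1≁x (suc zero)    (suc (suc b)) = ≡.sym (1≁x b)
  addSingleton-restrict π 1≁0 1≁x (suc (suc a)) zero          = ≡.refl
  addSingleton-restrict π 1≁0 1≁x (suc (suc a)) (suc zero)    = ≡.sym (≡.trans (rel-sym π (suc (suc a)) (suc zero)) (1≁x a))
  addSingleton-restrict π 1≁0 1≁x (suc (suc a)) (suc (suc b)) = ≡.refl

  DownClosedBlock : Fin (suc m) → Partition (suc m) → Set
  DownClosedBlock p π = ∀ b c → b Fin.< c → rel π p (suc c) ≡ true → rel π p (suc b) ≡ true

  addSingleton-intervals : (π : Partition (suc m)) → IntervalBlocks Fin._<_ π → IntervalBlocks Fin._<_ (addSingleton π)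
  addSingleton-intervals π I zero    zero    k       _         ()
  addSingleton-intervals π I zero    (suc j) k       _         _         ()
  addSingleton-intervals π I (suc i) j       zero    ()        _
  addSingleton-intervals π I (suc i) zero    (suc k) _         ()
  addSingleton-intervals π I (suc i) (suc j) (suc k) (s≤s i<k) (s≤s k<j) = I i j k i<k k<j

  addTo-intervals : (p : Fin (suc m)) (π : Partition (suc m)) → IntervalBlocks Fin._<_ π → DownClosedBlock p π →
                    IntervalBlocks Fin._<_ (addTo p π)
  addTo-intervals p π I D zero    zero    k       _         ()
  addTo-intervals p π I D zero    (suc j) zero    ()        _
  addTo-intervals p π I D zero    (suc j) (suc k) _         (s≤s k<j) = D k j k<j
  addTo-intervals p π I D (suc i) j       zero    ()        _
  addTo-intervals p π I D (suc i) zero    (suc k) _         ()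
  addTo-intervals p π I D (suc i) (suc j) (suc k) (s≤s i<k) (s≤s k<j) = I i j k i<k k<j

  first-downClosed : (π : Partition (suc (suc m))) → IntervalBlocks Fin._<_ π → DownClosedBlock (suc zero) π
  first-downClosed π I zero    c _ _ = reflP π (suc zero)
  first-downClosed π I (suc b) c   = I zero c (suc b) (s≤s z≤n)

  yAlone-downClosed : (π : Partition (suc m)) → YAlone π → DownClosedBlock zero π
  yAlone-downClosed π Y b c _ y~c = contradiction (Y c) (true≢false y~c)

  restrict-intervals : (π : Partition (suc (suc m))) → IntervalBlocks Fin._<_ π → IntervalBlocks Fin._<_ (restrict π)
  restrict-intervals π = IntervalBlocks-pullback suc s≤s {π}

  split-from-next⇒isolated-from-xs : (π : Partition (suc (suc (suc m)))) → IntervalBlocks Fin._<_ π →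
    rel π (suc zero) (suc (suc zero)) ≡ false → ∀ a → rel π (suc zero) (suc (suc a)) ≡ false
  split-from-next⇒isolated-from-xs π I 1≁2 zero    = 1≁2
  split-from-next⇒isolated-from-xs π I 1≁2 (suc a) =
    false-by-implication (I zero (suc (suc a)) (suc zero) (s≤s z≤n) (s≤s (s≤s z≤n))) 1≁2

  yAlone-restrict : (π : Partition (suc (suc m))) → rel π zero (suc zero) ≡ true →
                    (∀ a → rel π (suc zero) (suc (suc a)) ≡ false) → YAlone (restrict π)
  yAlone-restrict π 0~1 1≁x a = false-by-implication (transP π (suc zero) zero (suc (suc a)) (symP π zero (suc zero) 0~1)) (1≁x a)

  singleton : IntervalPartition m → IntervalPartition (suc m)
  singleton (π , I) = addSingleton π , addSingleton-intervals π I

  joinNext : IntervalPartition (suc m) → IntervalPartition (suc (suc m))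
  joinNext (π , I) = addTo (suc zero) π , addTo-intervals (suc zero) π I (first-downClosed π I)

  joinY : YAloneIntervalPartition m → IntervalPartition (suc m)
  joinY (π , I , Y) = addTo zero π , addTo-intervals zero π I (yAlone-downClosed π Y)

  singletonʸ : YAloneIntervalPartition m → YAloneIntervalPartition (suc m)
  singletonʸ (π , I , Y) = addSingleton π , addSingleton-intervals π I , λ { zero → ≡.refl ; (suc a) → Y a }

  joinNextʸ : YAloneIntervalPartition (suc m) → YAloneIntervalPartition (suc (suc m))
  joinNextʸ (π , I , Y) = addTo (suc zero) π , addTo-intervals (suc zero) π I (first-downClosed π I) ,
                          λ { zero → Y zero ; (suc a) → Y a }

  yAloneCount : ℕ → ℕ
  yAloneCount 0             = 1
  yAloneCount 1             = 1
  yAloneCount (suc (suc m)) = yAloneCount (suc m) + yAloneCount (suc m)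

  count : ℕ → ℕ
  count 0             = 1
  count 1             = count 0 + yAloneCount 0
  count (suc (suc m)) = count (suc m) + (count (suc m) + yAloneCount (suc m))

  indiscrete : Partition 1
  indiscrete = record { rel = λ _ _ → true ; reflP = λ _ → ≡.refl ; symP = λ _ _ t → t ; transP = λ _ _ _ t _ → t }

  indiscrete-unique : (π : Partition 1) → SamePartition indiscrete π
  indiscrete-unique π zero zero = ≡.sym (reflP π zero)

  HasCard-YAlone₀ : HasCard (YAloneIntervalPartition 0) _≋_ 1
  HasCard-YAlone₀ = (λ _ → indiscrete , (λ ()) , λ ()) , (λ { zero zero _ → ≡.refl }) ,
                    λ x → zero , indiscrete-unique (proj₁ x)

  HasCard-Interval₀ : HasCard (IntervalPartition 0) _≋_ 1
  HasCard-Interval₀ = (λ _ → indiscrete , λ ()) , (λ { zero zero _ → ≡.refl }) , λ x → zero , indiscrete-unique (proj₁ x)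

  addSingleton-injective : (π σ : Partition (suc m)) → SamePartition (addSingleton π) (addSingleton σ) → SamePartition π σ
  addSingleton-injective = restrict-injective addSingleton restrict-addSingleton

  addTo-injective : (p : Fin (suc m)) (π σ : Partition (suc m)) → SamePartition (addTo p π) (addTo p σ) → SamePartition π σ
  addTo-injective p = restrict-injective (addTo p) (restrict-addTo p)

  -- The constructions are told apart by whether x₁ (index 1) is linked to y (index 0) or to x₂ (index 2).
  singleton≉joinNext : (π σ : Partition (suc (suc m))) → ¬ SamePartition (addSingleton π) (addTo (suc zero) σ)
  singleton≉joinNext π σ e = true≢false (reflP σ (suc zero)) (≡.sym (e (suc zero) (suc (suc zero))))

  singleton≉joinY : (π σ : Partition (suc m)) → ¬ SamePartition (addSingleton π) (addTo zero σ)
  singleton≉joinY π σ e = true≢false (reflP σ zero) (≡.sym (e (suc zero) zero))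

  joinY≉joinNext : (π σ : Partition (suc (suc m))) → YAlone π → ¬ SamePartition (addTo zero π) (addTo (suc zero) σ)
  joinY≉joinNext π σ Y e = true≢false (reflP σ (suc zero)) (≡.trans (≡.sym (e (suc zero) (suc (suc zero)))) (Y zero))

  hasCardʸ : ∀ n → HasCard (YAloneIntervalPartition n) _≋_ (yAloneCount n)
  hasCardʸ zero = HasCard-YAlone₀
  hasCardʸ (suc zero) = HasCard-map-≋ {_~_ = _≋_} singletonʸ (λ {x} {y} → addSingleton-resp (proj₁ x) (proj₁ y))
    (λ x y → addSingleton-injective (proj₁ x) (proj₁ y)) surj HasCard-YAlone₀
    where
    surj : ∀ z → ∃ λ x → singletonʸ x ≋ z
    surj (π , I , Y) = (restrict π , restrict-intervals π I , λ ()) ,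
                       addSingleton-restrict π (≡.trans (rel-sym π (suc zero) zero) (Y zero)) (λ ())
  hasCardʸ (suc (suc m)) = HasCard-map-≋ {_~_ = Pointwise _≋_ _≋_} f resp refl surj
                                         (HasCard-⊎ (hasCardʸ (suc m)) (hasCardʸ (suc m)))
    where
    f : YAloneIntervalPartition (suc m) ⊎ YAloneIntervalPartition (suc m) → YAloneIntervalPartition (suc (suc m))
    f = [ singletonʸ , joinNextʸ ]
    resp : ∀ {x y} → Pointwise _≋_ _≋_ x y → f x ≋ f y
    resp {inj₁ x} {inj₁ y} (inj₁ x≋y) = addSingleton-resp (proj₁ x) (proj₁ y) x≋y
    resp {inj₂ x} {inj₂ y} (inj₂ x≋y) = pullback-resp (mergeNewInto (suc zero)) (proj₁ x) (proj₁ y) x≋y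
    refl : ∀ x y → f x ≋ f y → Pointwise _≋_ _≋_ x y
    refl (inj₁ x) (inj₁ y) e = inj₁ (addSingleton-injective (proj₁ x) (proj₁ y) e)
    refl (inj₂ x) (inj₂ y) e = inj₂ (addTo-injective (suc zero) (proj₁ x) (proj₁ y) e)
    refl (inj₁ x) (inj₂ y) e = ⊥-elim (singleton≉joinNext (proj₁ x) (proj₁ y) e)
    refl (inj₂ x) (inj₁ y) e = ⊥-elim (singleton≉joinNext (proj₁ y) (proj₁ x) (λ a b → ≡.sym (e a b)))
    surj : ∀ z → ∃ λ x → f x ≋ z
    surj (π , I , Y) with rel π (suc zero) (suc (suc zero)) in 1~2
    ... | true  = inj₂ (restrict π , restrict-intervals π I , (λ a → Y (suc a))) , addTo-restrict (suc zero) π 1~2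
    ... | false = inj₁ (restrict π , restrict-intervals π I , (λ a → Y (suc a))) ,
                  addSingleton-restrict π (≡.trans (rel-sym π (suc zero) zero) (Y zero)) (split-from-next⇒isolated-from-xs π I 1~2)

  hasCard : ∀ n → HasCard (IntervalPartition n) _≋_ (count n)
  hasCard zero = HasCard-Interval₀
  hasCard (suc zero) = HasCard-map-≋ {_~_ = Pointwise _≋_ _≋_} f resp refl surj
                                     (HasCard-⊎ HasCard-Interval₀ HasCard-YAlone₀)
    where
    f : IntervalPartition 0 ⊎ YAloneIntervalPartition 0 → IntervalPartition 1
    f = [ singleton , joinY ]
    resp : ∀ {x y} → Pointwise _≋_ _≋_ x y → f x ≋ f y
    resp {inj₁ x} {inj₁ y} (inj₁ x≋y) = addSingleton-resp (proj₁ x) (proj₁ y) x≋y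
    resp {inj₂ x} {inj₂ y} (inj₂ x≋y) = pullback-resp (mergeNewInto zero) (proj₁ x) (proj₁ y) x≋y
    refl : ∀ x y → f x ≋ f y → Pointwise _≋_ _≋_ x y
    refl (inj₁ x) (inj₁ y) e = inj₁ (addSingleton-injective (proj₁ x) (proj₁ y) e)
    refl (inj₂ x) (inj₂ y) e = inj₂ (addTo-injective zero (proj₁ x) (proj₁ y) e)
    refl (inj₁ x) (inj₂ y) e = ⊥-elim (singleton≉joinY (proj₁ x) (proj₁ y) e)
    refl (inj₂ x) (inj₁ y) e = ⊥-elim (singleton≉joinY (proj₁ y) (proj₁ x) (λ a b → ≡.sym (e a b)))
    surj : ∀ z → ∃ λ x → f x ≋ z
    surj (π , I) with rel π zero (suc zero) in 0~1
    ... | true  = inj₂ (restrict π , restrict-intervals π I , yAlone-restrict π 0~1 λ ()) ,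
                  addTo-restrict zero π (symP π zero (suc zero) 0~1)
    ... | false = inj₁ (restrict π , restrict-intervals π I) ,
                  addSingleton-restrict π (≡.trans (rel-sym π (suc zero) zero) 0~1) (λ ())
  hasCard (suc (suc m)) = HasCard-map-≋ {_~_ = Pointwise _≋_ (Pointwise _≋_ _≋_)} f resp refl surj
                                        (HasCard-⊎ (hasCard (suc m)) (HasCard-⊎ (hasCard (suc m)) (hasCardʸ (suc m))))
    where
    f : IntervalPartition (suc m) ⊎ (IntervalPartition (suc m) ⊎ YAloneIntervalPartition (suc m)) → IntervalPartition (suc (suc m))
    f = [ singleton , [ joinNext , joinY ] ]
    resp : ∀ {x y} → Pointwise _≋_ (Pointwise _≋_ _≋_) x y → f x ≋ f y
    resp {inj₁ x}        {inj₁ y}        (inj₁ x≋y)        = addSingleton-resp (proj₁ x) (proj₁ y) x≋y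
    resp {inj₂ (inj₁ x)} {inj₂ (inj₁ y)} (inj₂ (inj₁ x≋y)) = pullback-resp (mergeNewInto (suc zero)) (proj₁ x) (proj₁ y) x≋y
    resp {inj₂ (inj₂ x)} {inj₂ (inj₂ y)} (inj₂ (inj₂ x≋y)) = pullback-resp (mergeNewInto zero) (proj₁ x) (proj₁ y) x≋y
    refl : ∀ x y → f x ≋ f y → Pointwise _≋_ (Pointwise _≋_ _≋_) x y
    refl (inj₁ x)        (inj₁ y)        e = inj₁ (addSingleton-injective (proj₁ x) (proj₁ y) e)
    refl (inj₂ (inj₁ x)) (inj₂ (inj₁ y)) e = inj₂ (inj₁ (addTo-injective (suc zero) (proj₁ x) (proj₁ y) e))
    refl (inj₂ (inj₂ x)) (inj₂ (inj₂ y)) e = inj₂ (inj₂ (addTo-injective zero (proj₁ x) (proj₁ y) e))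
    refl (inj₁ x)        (inj₂ (inj₁ y)) e = ⊥-elim (singleton≉joinNext (proj₁ x) (proj₁ y) e)
    refl (inj₂ (inj₁ x)) (inj₁ y)        e = ⊥-elim (singleton≉joinNext (proj₁ y) (proj₁ x) (λ a b → ≡.sym (e a b)))
    refl (inj₁ x)        (inj₂ (inj₂ y)) e = ⊥-elim (singleton≉joinY (proj₁ x) (proj₁ y) e)
    refl (inj₂ (inj₂ x)) (inj₁ y)        e = ⊥-elim (singleton≉joinY (proj₁ y) (proj₁ x) (λ a b → ≡.sym (e a b)))
    refl (inj₂ (inj₂ x)) (inj₂ (inj₁ y)) e = ⊥-elim (joinY≉joinNext (proj₁ x) (proj₁ y) (proj₂ (proj₂ x)) e)
    refl (inj₂ (inj₁ x)) (inj₂ (inj₂ y)) e = ⊥-elim (joinY≉joinNext (proj₁ y) (proj₁ x) (proj₂ (proj₂ y)) (λ a b → ≡.sym (e a b)))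
    surj : ∀ z → ∃ λ x → f x ≋ z
    surj (π , I) with rel π (suc zero) (suc (suc zero)) in 1~2
    ... | true = inj₂ (inj₁ (restrict π , restrict-intervals π I)) , addTo-restrict (suc zero) π 1~2
    ... | false with rel π zero (suc zero) in 0~1
    ...   | true  = inj₂ (inj₂ (restrict π , restrict-intervals π I , yAlone-restrict π 0~1 (split-from-next⇒isolated-from-xs π I 1~2))) ,
                    addTo-restrict zero π (symP π zero (suc zero) 0~1)
    ...   | false = inj₁ (restrict π , restrict-intervals π I) ,
                    addSingleton-restrict π (≡.trans (rel-sym π (suc zero) zero) 0~1) (split-from-next⇒isolated-from-xs π I 1~2)

  count-recurrence : ∀ m → count (3 + m) + 4 * count (1 + m) ≡ 4 * count (2 + m)
  count-recurrence m = solve 2 (λ t q → ((t :+ (t :+ q)) :+ ((t :+ (t :+ q)) :+ (q :+ q))) :+ con 4 :* t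
                                        := con 4 :* (t :+ (t :+ q))) ≡.refl (count (suc m)) (yAloneCount (suc m))
    where open import Data.Nat.Solver using (module +-*-Solver)
          open +-*-Solver

module CauchyProduct where
  open import Data.Nat as ℕ using (ℕ; zero; suc; _∸_; _≤_; z≤n)
  import Data.Nat.Properties as ℕ
  open import Data.Integer as ℤ using (ℤ; +_; -[1+_])
  import Data.Integer.Properties as ℤ
  open import Relation.Binary.PropositionalEquality as ≡ using (_≡_)

  -- Defs keeps the finite sum behind _⋆_ private; unification recovers it.
  mutual
    sumUpTo : ℕ → (ℕ → ℤ) → ℤ
    sumUpTo = _

    ⋆-sumUpTo : ∀ f g n → (f ⋆ g) n ≡ sumUpTo n (λ k → f k ℤ.* g (n ∸ k))
    ⋆-sumUpTo f g n with (λ k → f k ℤ.* g (n ∸ k))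
    ... | h = ≡.refl

  sumUpTo-zero : ∀ n {h} → (∀ k → k ≤ n → h k ≡ + 0) → sumUpTo n h ≡ + 0
  sumUpTo-zero zero    h≗0 = h≗0 0 z≤n
  sumUpTo-zero (suc n) h≗0 =
    ≡.cong₂ ℤ._+_ (h≗0 (suc n) ℕ.≤-refl) (sumUpTo-zero n λ k k≤n → h≗0 k (ℕ.m≤n⇒m≤1+n k≤n))

  linear⋆linear : ∀ f g → (∀ i → f (2 ℕ.+ i) ≡ + 0) → (∀ i → g (2 ℕ.+ i) ≡ + 0) →
                  ∀ k → (f ⋆ g) (3 ℕ.+ k) ≡ + 0
  linear⋆linear f g f≥2 g≥2 k = ≡.trans (⋆-sumUpTo f g (3 ℕ.+ k)) (sumUpTo-zero (3 ℕ.+ k) term)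
    where
    term : ∀ i → i ≤ 3 ℕ.+ k → f i ℤ.* g (3 ℕ.+ k ∸ i) ≡ + 0
    term 0             _ = ≡.trans (≡.cong (f 0 ℤ.*_) (g≥2 (suc k))) (ℤ.*-zeroʳ (f 0))
    term 1             _ = ≡.trans (≡.cong (f 1 ℤ.*_) (g≥2 k)) (ℤ.*-zeroʳ (f 1))
    term (suc (suc i)) _ = ≡.trans (≡.cong (ℤ._* g (1 ℕ.+ k ∸ i)) (f≥2 i)) (ℤ.*-zeroˡ (g (1 ℕ.+ k ∸ i)))

  ⋆-quadratic : ∀ f g → (∀ i → g (3 ℕ.+ i) ≡ + 0) → ∀ m →
                (f ⋆ g) (3 ℕ.+ m) ≡ f (3 ℕ.+ m) ℤ.* g 0 ℤ.+ (f (2 ℕ.+ m) ℤ.* g 1 ℤ.+ (f (1 ℕ.+ m) ℤ.* g 2 ℤ.+ + 0))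
  ⋆-quadratic f g g≥3 m = ≡.trans (⋆-sumUpTo f g (3 ℕ.+ m))
    (≡.cong₂ ℤ._+_ (coefficient 3 0 (ℕ.n∸n≡0 (3 ℕ.+ m)))
    (≡.cong₂ ℤ._+_ (coefficient 2 1 (ℕ.m+n∸n≡m 1 m))
    (≡.cong₂ ℤ._+_ (coefficient 1 2 (ℕ.m+n∸n≡m 2 m)) tail-vanishes)))
    where
    coefficient : ∀ a b → 3 ℕ.+ m ∸ (a ℕ.+ m) ≡ b →
                  f (a ℕ.+ m) ℤ.* g (3 ℕ.+ m ∸ (a ℕ.+ m)) ≡ f (a ℕ.+ m) ℤ.* g b
    coefficient a b eq = ≡.cong (λ j → f (a ℕ.+ m) ℤ.* g j) eq
    tail-vanishes : sumUpTo m (λ i → f i ℤ.* g (3 ℕ.+ m ∸ i)) ≡ + 0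
    tail-vanishes = sumUpTo-zero m λ i i≤m → begin
      f i ℤ.* g (3 ℕ.+ m ∸ i)    ≡⟨ ≡.cong (λ j → f i ℤ.* g j) (ℕ.+-∸-assoc 3 i≤m) ⟩
      f i ℤ.* g (3 ℕ.+ (m ∸ i))  ≡⟨ ≡.cong (f i ℤ.*_) (g≥3 (m ∸ i)) ⟩
      f i ℤ.* + 0                ≡⟨ ℤ.*-zeroʳ (f i) ⟩
      + 0                        ∎
      where open ≡.≡-Reasoning

  [1-2x] [1-x] [1-2x]² [1-x]² : Series
  [1-2x]  = oneₛ ⊖ₛ ((+ 2) ·ₛ Xₛ)
  [1-x]   = oneₛ ⊖ₛ Xₛ
  [1-2x]² = [1-2x] ⋆ [1-2x]
  [1-x]²  = [1-x] ⋆ [1-x]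

  gf-from-recurrence : (t : ℕ → ℕ) → t 0 ≡ 1 → t 1 ≡ 2 → t 2 ≡ 5 →
                       (∀ m → t (3 ℕ.+ m) ℕ.+ 4 ℕ.* t (1 ℕ.+ m) ≡ 4 ℕ.* t (2 ℕ.+ m)) →
                       ∀ k → (gf t ⋆ [1-2x]²) k ≡ [1-x]² k
  gf-from-recurrence t t₀ t₁ t₂ rec 0 rewrite t₀ = ≡.refl
  gf-from-recurrence t t₀ t₁ t₂ rec 1 rewrite t₀ | t₁ = ≡.refl
  gf-from-recurrence t t₀ t₁ t₂ rec 2 rewrite t₀ | t₁ | t₂ = ≡.refl
  gf-from-recurrence t t₀ t₁ t₂ rec (suc (suc (suc m))) = begin
    (gf t ⋆ [1-2x]²) (3 ℕ.+ m)
      ≡⟨ ⋆-quadratic (gf t) [1-2x]² (linear⋆linear [1-2x] [1-2x] (λ _ → ≡.refl) (λ _ → ≡.refl)) m ⟩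
    a ℤ.* + 1 ℤ.+ (b ℤ.* -[1+ 3 ] ℤ.+ (c ℤ.* + 4 ℤ.+ + 0))
      ≡⟨ solve 3 (λ a b c → a :* con (+ 1) :+ (b :* con -[1+ 3 ] :+ (c :* con (+ 4) :+ con (+ 0)))
                            := (a :+ con (+ 4) :* c) :- con (+ 4) :* b) ≡.refl a b c ⟩
    (a ℤ.+ + 4 ℤ.* c) ℤ.- + 4 ℤ.* b
      ≡⟨ ≡.cong (ℤ._- (+ 4 ℤ.* b)) recurrenceℤ ⟩
    + 4 ℤ.* b ℤ.- + 4 ℤ.* b
      ≡⟨ ℤ.+-inverseʳ (+ 4 ℤ.* b) ⟩
    + 0
      ≡⟨ linear⋆linear [1-x] [1-x] (λ _ → ≡.refl) (λ _ → ≡.refl) m ⟨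
    [1-x]² (3 ℕ.+ m) ∎
    where
    open ≡.≡-Reasoning
    open import Data.Integer.Solver using (module +-*-Solver)
    open +-*-Solver
    a b c : ℤ
    a = + t (3 ℕ.+ m)
    b = + t (2 ℕ.+ m)
    c = + t (1 ℕ.+ m)
    recurrenceℤ : a ℤ.+ + 4 ℤ.* c ≡ + 4 ℤ.* b
    recurrenceℤ = begin
      a ℤ.+ + 4 ℤ.* c                        ≡⟨ ≡.cong (λ x → a ℤ.+ x) (ℤ.pos-* 4 (t (1 ℕ.+ m))) ⟨
      a ℤ.+ + (4 ℕ.* t (1 ℕ.+ m))            ≡⟨ ℤ.pos-+ (t (3 ℕ.+ m)) (4 ℕ.* t (1 ℕ.+ m)) ⟨
      + (t (3 ℕ.+ m) ℕ.+ 4 ℕ.* t (1 ℕ.+ m))  ≡⟨ ≡.cong +_ (rec m) ⟩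
      + (4 ℕ.* t (2 ℕ.+ m))                  ≡⟨ ℤ.pos-* 4 (t (2 ℕ.+ m)) ⟩
      + 4 ℤ.* b                              ∎

module Configuration {c ℓ₁ ℓ₂} (F : OrderedField c ℓ₁ ℓ₂) {n} (T : Geometry.Config F n) where
  open import Level using (_⊔_)
  open import Data.Nat using (zero; suc)
  open import Data.Empty using (⊥; ⊥-elim)
  open import Data.Fin using (Fin; zero; suc)
  open import Data.Bool using (Bool; true; false)
  open import Data.Product using (∃; ∃₂; _×_; _,_; proj₁; proj₂)
  open import Data.Sum using (_⊎_; inj₁; inj₂)
  open import Relation.Binary.PropositionalEquality as ≡ using (_≡_)
  open import Relation.Nullary using (¬_; contradiction)
  open OrderedField F hiding (_≤_; zero)
  open OrderedFieldProperties F
  open IntegerCoefficientSolver commRing using (solve; _:+_; _:*_; _:-_; :-_; _:=_)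
  open ConvexHulls F
  open Geometry F
  open Config T
  open FinOrder totalOrder using (maximum; minimum)
  open Partitions using (IntervalBlocks; true≢false; rel-sym)
  open import Relation.Binary.Reasoning.PartialOrder poset

  a d : Point
  a = proj₁ line
  d = proj₁ (proj₂ line)

  d≉0 : ¬ (d ≈ₚ origin)
  d≉0 = proj₁ (proj₂ (proj₂ line))

  τ : Fin n → Carrier
  τ i = proj₁ (proj₁ (proj₂ (proj₂ (proj₂ line))) i)

  xs-on-line : ∀ i → xs i ≈ₚ along a (τ i) d
  xs-on-line i = proj₂ (proj₁ (proj₂ (proj₂ (proj₂ line))) i)

  y-off-line : ∀ t → ¬ (y ≈ₚ along a t d)
  y-off-line = proj₂ (proj₂ (proj₂ (proj₂ line)))

  τ-injective : ∀ i j → τ i ≈ τ j → i ≡ j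
  τ-injective i j τi≈τj = distinct i j
    ( trans (proj₁ (xs-on-line i)) (trans (+-congˡ (*-congʳ τi≈τj)) (sym (proj₁ (xs-on-line j))))
    , trans (proj₂ (xs-on-line i)) (trans (+-congˡ (*-congʳ τi≈τj)) (sym (proj₂ (xs-on-line j)))))

  level : Carrier → Carrier → Carrier → Carrier
  level α β t = φ α β a + t * φ α β d

  φ-xs : ∀ α β k → φ α β (xs k) ≈ level α β (τ k)
  φ-xs α β k = begin-equality
    α * proj₁ (xs k) + β * proj₂ (xs k)
      ≈⟨ +-cong (*-congˡ (proj₁ (xs-on-line k))) (*-congˡ (proj₂ (xs-on-line k))) ⟩
    α * (proj₁ a + τ k * proj₁ d) + β * (proj₂ a + τ k * proj₂ d)
      ≈⟨ solve 7 (λ α β a₁ a₂ t d₁ d₂ → α :* (a₁ :+ t :* d₁) :+ β :* (a₂ :+ t :* d₂)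
                                         := (α :* a₁ :+ β :* a₂) :+ t :* (α :* d₁ :+ β :* d₂))
                 refl α β (proj₁ a) (proj₂ a) (τ k) (proj₁ d) (proj₂ d) ⟩
    level α β (τ k) ∎

  level-mono-≤ : ∀ {α β} → 0# ≤ φ α β d → ∀ {t t′} → t ≤ t′ → level α β t ≤ level α β t′
  level-mono-≤ {α} {β} 0≤φd t≤t′ = +-monoʳ-≤ (φ α β a) (*-monoʳ-≤-nonNeg 0≤φd t≤t′)

  level-mono-< : ∀ {α β} → 0# < φ α β d → ∀ {t t′} → t < t′ → level α β t < level α β t′
  level-mono-< {α} {β} (0≤φd , 0≉φd) {t} {t′} (t≤t′ , t≉t′) = level-mono-≤ 0≤φd t≤t′ , λ eq →
    x≉0∧y≉0⇒x*y≉0 t′-t≉0 φd≉0 (begin-equality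
      (t′ - t) * φ α β d           ≈⟨ solve 4 (λ p t t′ q → (t′ :- t) :* q := (p :+ t′ :* q) :- (p :+ t :* q))
                                               refl (φ α β a) t t′ (φ α β d) ⟩
      level α β t′ - level α β t   ≈⟨ +-congˡ (-‿cong eq) ⟩
      level α β t′ - level α β t′  ≈⟨ -‿inverseʳ _ ⟩
      0#                           ∎)
    where
    t′-t≉0 : ¬ (t′ - t ≈ 0#)
    t′-t≉0 t′-t≈0 = t≉t′ (sym (y-x≈0⇒y≈x t′-t≈0))
    φd≉0 : ¬ (φ α β d ≈ 0#)
    φd≉0 φd≈0 = 0≉φd (sym φd≈0)

  orient : ∀ α β {s} → ¬ (φ α β d ≈ 0#) → φ α β y ≈ level α β s →
           ∃₂ λ α′ β′ → 0# < φ α′ β′ d × φ α′ β′ y ≈ level α′ β′ s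
  orient α β {s} φd≉0 φy≈ with total 0# (φ α β d)
  ... | inj₁ 0≤φd = α , β , (0≤φd , λ 0≈φd → φd≉0 (sym 0≈φd)) , φy≈
  ... | inj₂ φd≤0 =
    - α , - β , (0≤φ⁻d , λ 0≈φ⁻d → φd≉0 (neg≈0 (trans (sym (φ-neg α β d)) (sym 0≈φ⁻d)))) , φ⁻y≈
    where
    open import Algebra.Properties.Ring ring using (-‿involutive; -0#≈0#)
    neg≈0 : ∀ {x} → - x ≈ 0# → x ≈ 0#
    neg≈0 {x} -x≈0 = trans (sym (-‿involutive x)) (trans (-‿cong -x≈0) -0#≈0#)
    0≤φ⁻d : 0# ≤ φ (- α) (- β) d
    0≤φ⁻d = ≤-respʳ-≈ (sym (φ-neg α β d)) (nonPos⇒0≤neg φd≤0)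
    φ⁻y≈ : φ (- α) (- β) y ≈ level (- α) (- β) s
    φ⁻y≈ = begin-equality
      φ (- α) (- β) y            ≈⟨ φ-neg α β y ⟩
      - φ α β y                  ≈⟨ -‿cong φy≈ ⟩
      - level α β s              ≈⟨ solve 3 (λ p s q → :- (p :+ s :* q) := (:- p) :+ s :* (:- q)) refl (φ α β a) s (φ α β d) ⟩
      - φ α β a + s * - φ α β d  ≈⟨ +-cong (φ-neg α β a) (*-congˡ (φ-neg α β d)) ⟨
      level (- α) (- β) s        ∎

  -- φ α₀ β₀ vanishes on the direction from a + s·d to y, so y sits at the level of that point.
  transversal : ∀ s → ∃₂ λ α β → 0# < φ α β d × φ α β y ≈ level α β s
  transversal s = orient α₀ β₀ φ₀d≉0 φ₀y
    where
    e₁ e₂ α₀ β₀ : Carrier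
    e₁ = proj₁ y - (proj₁ a + s * proj₁ d)
    e₂ = proj₂ y - (proj₂ a + s * proj₂ d)
    α₀ = - e₂
    β₀ = e₁
    φ₀y : φ α₀ β₀ y ≈ level α₀ β₀ s
    φ₀y = solve 7 (λ y₁ y₂ a₁ a₂ s d₁ d₂ →
            (:- (y₂ :- (a₂ :+ s :* d₂))) :* y₁ :+ (y₁ :- (a₁ :+ s :* d₁)) :* y₂
            := ((:- (y₂ :- (a₂ :+ s :* d₂))) :* a₁ :+ (y₁ :- (a₁ :+ s :* d₁)) :* a₂)
               :+ s :* ((:- (y₂ :- (a₂ :+ s :* d₂))) :* d₁ :+ (y₁ :- (a₁ :+ s :* d₁)) :* d₂))
            refl (proj₁ y) (proj₂ y) (proj₁ a) (proj₂ a) s (proj₁ d) (proj₂ d)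
    y-on-line : ∀ r → e₁ ≈ r * proj₁ d → e₂ ≈ r * proj₂ d → y ≈ₚ along a (s + r) d
    y-on-line r e₁≈ e₂≈ = coordinate e₁≈ , coordinate e₂≈
      where
      coordinate : ∀ {yᵢ aᵢ dᵢ} → yᵢ - (aᵢ + s * dᵢ) ≈ r * dᵢ → yᵢ ≈ aᵢ + (s + r) * dᵢ
      coordinate {yᵢ} {aᵢ} {dᵢ} eᵢ≈ = begin-equality
        yᵢ                                    ≈⟨ solve 4 (λ y a s d → y := (a :+ s :* d) :+ (y :- (a :+ s :* d))) refl yᵢ aᵢ s dᵢ ⟩
        (aᵢ + s * dᵢ) + (yᵢ - (aᵢ + s * dᵢ))  ≈⟨ +-congˡ eᵢ≈ ⟩
        (aᵢ + s * dᵢ) + r * dᵢ                ≈⟨ solve 4 (λ a s r d → (a :+ s :* d) :+ r :* d := a :+ (s :+ r) :* d) refl aᵢ s r dᵢ ⟩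
        aᵢ + (s + r) * dᵢ                     ∎
    φ₀d≉0 : ¬ (φ α₀ β₀ d ≈ 0#)
    φ₀d≉0 φ₀d≈0 = ¬¬d₁≈0 λ d₁≈0 → ¬¬d₂≈0 λ d₂≈0 → d≉0 (d₁≈0 , d₂≈0)
      where
      e₁d₂≈e₂d₁ : e₁ * proj₂ d ≈ e₂ * proj₁ d
      e₁d₂≈e₂d₁ = y-x≈0⇒y≈x (trans (solve 4 (λ e₁ e₂ d₁ d₂ → e₁ :* d₂ :- e₂ :* d₁ := (:- e₂) :* d₁ :+ e₁ :* d₂)
                                           refl e₁ e₂ (proj₁ d) (proj₂ d)) φ₀d≈0)
      ¬¬d₁≈0 : ¬ ¬ (proj₁ d ≈ 0#)
      ¬¬d₁≈0 d₁≉0 = let (r , e₁≈ , e₂≈) = parallel⇒multiple d₁≉0 e₁d₂≈e₂d₁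
                    in y-off-line (s + r) (y-on-line r e₁≈ e₂≈)
      ¬¬d₂≈0 : ¬ ¬ (proj₂ d ≈ 0#)
      ¬¬d₂≈0 d₂≉0 = let (r , e₂≈ , e₁≈) = parallel⇒multiple d₂≉0 (sym e₁d₂≈e₂d₁)
                    in y-off-line (s + r) (y-on-line r e₁≈ e₂≈)

  _≺_ : Fin n → Fin n → Set (ℓ₁ ⊔ ℓ₂)
  i ≺ j = τ i < τ j

  Convex : (Fin n → Bool) → Set (ℓ₁ ⊔ ℓ₂)
  Convex B = ∀ i j k → B i ≡ true → B j ≡ true → i ≺ k → k ≺ j → B k ≡ true

  _≤ᴮ_ : (Fin n → Bool) → Carrier → Set ℓ₂
  B ≤ᴮ s = ∀ k → B k ≡ true → τ k ≤ s

  _ᴮ≤_ : Carrier → (Fin n → Bool) → Set ℓ₂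
  s ᴮ≤ B = ∀ k → B k ≡ true → s ≤ τ k

  module _ (B₁ B₂ : Fin n → Bool) (disjoint : ∀ k → B₁ k ≡ true → B₂ k ≡ true → ⊥) where
    private
      strict₁₂ : ∀ {i j} → B₁ i ≡ true → B₂ j ≡ true → τ i ≤ τ j → τ i < τ j
      strict₁₂ {i} {j} B₁i B₂j τi≤τj = ≤∧≉⇒< τi≤τj λ τi≈τj →
        disjoint i B₁i (≡.subst (λ k → B₂ k ≡ true) (≡.sym (τ-injective i j τi≈τj)) B₂j)
      strict₂₁ : ∀ {i j} → B₂ i ≡ true → B₁ j ≡ true → τ i ≤ τ j → τ i < τ j
      strict₂₁ {i} {j} B₂i B₁j τi≤τj = ≤∧≉⇒< τi≤τj λ τi≈τj →
        disjoint j B₁j (≡.subst (λ k → B₂ k ≡ true) (τ-injective i j τi≈τj) B₂i)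

    disjoint-convex⇒separated : Convex B₁ → Convex B₂ → ∀ {k₂} → B₂ k₂ ≡ true →
      ∃₂ λ s t → s < t × ((B₁ ≤ᴮ s × t ᴮ≤ B₂) ⊎ (B₂ ≤ᴮ s × t ᴮ≤ B₁))
    disjoint-convex⇒separated B₁-convex B₂-convex {k₂} B₂k₂
      with minimum B₂ τ | maximum B₂ τ | maximum B₁ τ | minimum B₁ τ
    ... | inj₁ empty | _ | _ | _ = ⊥-elim (true≢false B₂k₂ (empty k₂))
    ... | inj₂ _ | inj₁ empty | _ | _ = ⊥-elim (true≢false B₂k₂ (empty k₂))
    ... | inj₂ (m₂ , B₂m₂ , m₂-min) | inj₂ (M₂ , B₂M₂ , M₂-max) | inj₁ B₁-empty | _ =
      τ m₂ - 1# , τ m₂ , x-1<x (τ m₂) , inj₁ ((λ k B₁k → ⊥-elim (true≢false B₁k (B₁-empty k))) , m₂-min)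
    ... | inj₂ (m₂ , B₂m₂ , m₂-min) | inj₂ (M₂ , B₂M₂ , M₂-max) | inj₂ (M₁ , B₁M₁ , M₁-max) | inj₁ B₁-empty =
      ⊥-elim (true≢false B₁M₁ (B₁-empty M₁))
    ... | inj₂ (m₂ , B₂m₂ , m₂-min) | inj₂ (M₂ , B₂M₂ , M₂-max) | inj₂ (M₁ , B₁M₁ , M₁-max) | inj₂ (m₁ , B₁m₁ , m₁-min)
      with total (τ M₁) (τ m₂) | total (τ M₂) (τ m₁)
    ...   | inj₁ M₁≤m₂ | _ = τ M₁ , τ m₂ , strict₁₂ B₁M₁ B₂m₂ M₁≤m₂ , inj₁ (M₁-max , m₂-min)
    ...   | inj₂ _ | inj₁ M₂≤m₁ = τ M₂ , τ m₁ , strict₂₁ B₂M₂ B₁m₁ M₂≤m₁ , inj₂ (M₂-max , m₁-min)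
    -- Otherwise the ranges overlap, and the set with the smaller minimum contains the other minimum.
    ...   | inj₂ m₂≤M₁ | inj₂ m₁≤M₂ with total (τ m₁) (τ m₂)
    ...     | inj₁ m₁≤m₂ =
      ⊥-elim (disjoint m₂ (B₁-convex m₁ M₁ m₂ B₁m₁ B₁M₁ (strict₁₂ B₁m₁ B₂m₂ m₁≤m₂) (strict₂₁ B₂m₂ B₁M₁ m₂≤M₁)) B₂m₂)
    ...     | inj₂ m₂≤m₁ =
      ⊥-elim (disjoint m₁ B₁m₁ (B₂-convex m₂ M₂ m₁ B₂m₂ B₂M₂ (strict₂₁ B₂m₂ B₁m₁ m₂≤m₁) (strict₁₂ B₁m₁ B₂M₂ m₁≤M₂)))

  pts : Fin (suc n) → Point
  pts = points T

  xPart : (Fin (suc n) → Bool) → Fin n → Bool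
  xPart S k = S (suc k)

  module _ {α β} (0<φd : 0# < φ α β d) where

    below-level : ∀ (S : Fin (suc n) → Bool) {s} → (S zero ≡ true → φ α β y ≤ level α β s) → xPart S ≤ᴮ s →
                  ∀ k → S k ≡ true → φ α β (pts k) ≤ level α β s
    below-level S y-below xs-below zero    Sk = y-below Sk
    below-level S y-below xs-below (suc k) Sk = ≤-respˡ-≈ (sym (φ-xs α β k)) (level-mono-≤ (proj₁ 0<φd) (xs-below k Sk))

    above-level : ∀ (S : Fin (suc n) → Bool) {s} → (S zero ≡ true → level α β s ≤ φ α β y) → s ᴮ≤ xPart S →
                  ∀ k → S k ≡ true → level α β s ≤ φ α β (pts k)
    above-level S y-above xs-above zero    Sk = y-above Sk
    above-level S y-above xs-above (suc k) Sk = ≤-respʳ-≈ (sym (φ-xs α β k)) (level-mono-≤ (proj₁ 0<φd) (xs-above k Sk))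

  separated⇒hulls-disjoint : (S U : Fin (suc n) → Bool) → U zero ≡ false → ∀ {s t} → s < t →
    (xPart S ≤ᴮ s × t ᴮ≤ xPart U) ⊎ (xPart U ≤ᴮ s × t ᴮ≤ xPart S) →
    ¬ (∃ λ p → InHull pts S p × InHull pts U p)
  separated⇒hulls-disjoint S U y∉U {s} {t} s<t (inj₁ (S≤s , t≤U)) =
    let (α , β , 0<φd , φy≈) = transversal s in
    separated⇒disjoint-hulls pts α β (level α β s) (level α β t) (level-mono-< 0<φd s<t)
      (below-level 0<φd S (λ _ → ≤-reflexive φy≈) S≤s)
      (above-level 0<φd U (λ y∈U → ⊥-elim (true≢false y∈U y∉U)) t≤U)
  separated⇒hulls-disjoint S U y∉U {s} {t} s<t (inj₂ (U≤s , t≤S)) (p , p∈S , p∈U) =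
    let (α , β , 0<φd , φy≈) = transversal t in
    separated⇒disjoint-hulls pts α β (level α β s) (level α β t) (level-mono-< 0<φd s<t)
      (below-level 0<φd U (λ y∈U → ⊥-elim (true≢false y∈U y∉U)) U≤s)
      (above-level 0<φd S (λ _ → ≤-reflexive (sym φy≈)) t≤S) (p , p∈U , p∈S)

  block-convex : (π : Partition (suc n)) → IntervalBlocks _≺_ π → ∀ u → Convex (xPart (rel π u))
  block-convex π I u i j k ui uj i≺k k≺j =
    transP π u (suc i) (suc k) ui (I i j k i≺k k≺j (transP π (suc i) u (suc j) (symP π u (suc i) ui) uj))

  module _ (π : Partition (suc n)) (I : IntervalBlocks _≺_ π) where

    blocks-disjoint-off-y : ∀ u v → rel π u v ≡ false → rel π v zero ≡ false →
                            ¬ (∃ λ p → InHull pts (rel π u) p × InHull pts (rel π v) p)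
    blocks-disjoint-off-y u zero    _   y≁y = λ _ → true≢false (reflP π zero) y≁y
    blocks-disjoint-off-y u (suc v) u≁v v≁y =
      let (s , t , s<t , separated) = disjoint-convex⇒separated (xPart (rel π u)) (xPart (rel π (suc v)))
            (λ k uk vk → true≢false (transP π u (suc k) (suc v) uk (symP π (suc v) (suc k) vk)) u≁v)
            (block-convex π I u) (block-convex π I (suc v)) (reflP π (suc v))
      in separated⇒hulls-disjoint (rel π u) (rel π (suc v)) v≁y s<t separated

    intervals⇒noncrossing : NonCrossing pts π
    intervals⇒noncrossing u v u≁v with rel π v zero in v~y
    ... | false = blocks-disjoint-off-y u v u≁v v~y
    ... | true with rel π u zero in u~y
    ...   | true  = λ _ → true≢false (transP π u zero v u~y (symP π v zero v~y)) u≁v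
    ...   | false = λ (p , p∈u , p∈v) → blocks-disjoint-off-y v u (≡.trans (rel-sym π v u) u≁v) u~y (p , p∈v , p∈u)

  between⇒in-hull : ∀ {i j k} → i ≺ k → k ≺ j → (S : Fin (suc n) → Bool) → S (suc i) ≡ true → S (suc j) ≡ true →
                    InHull pts S (xs k)
  between⇒in-hull {i} {j} {k} i≺k k≺j S Si Sj =
    let (λᵢ , λⱼ , 0≤λᵢ , 0≤λⱼ , λᵢ+λⱼ≈1 , combination) = between⇒convex-combination i≺k k≺j
        coordinate : ∀ {Xᵢ Xⱼ Xₖ A D} → Xᵢ ≈ A + τ i * D → Xⱼ ≈ A + τ j * D → Xₖ ≈ A + τ k * D →
                     λᵢ * Xᵢ + λⱼ * Xⱼ ≈ Xₖ
        coordinate Xᵢ≈ Xⱼ≈ Xₖ≈ = trans (+-cong (*-congˡ Xᵢ≈) (*-congˡ Xⱼ≈)) (trans (combination _ _) (sym Xₖ≈))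
    in segment⊆hull pts Si Sj 0≤λᵢ 0≤λⱼ λᵢ+λⱼ≈1 (xs k)
         (coordinate (proj₁ (xs-on-line i)) (proj₁ (xs-on-line j)) (proj₁ (xs-on-line k)))
         (coordinate (proj₂ (xs-on-line i)) (proj₂ (xs-on-line j)) (proj₂ (xs-on-line k)))

  noncrossing⇒intervals : (π : Partition (suc n)) → NonCrossing pts π → IntervalBlocks _≺_ π
  noncrossing⇒intervals π nc i j k i≺k k≺j i~j with rel π (suc i) (suc k) in i~k
  ... | true  = ≡.refl
  ... | false = contradiction
    (xs k , between⇒in-hull i≺k k≺j (rel π (suc i)) (reflP π (suc i)) i~j , vertex∈hull pts (reflP π (suc k)))
    (nc (suc i) (suc k) i~k)

module NoncrossingCount {c ℓ₁ ℓ₂} (F : OrderedField c ℓ₁ ℓ₂) {n} (T : Geometry.Config F n) where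
  open import Data.Nat using (suc)
  open import Data.Fin as Fin using (Fin; zero; suc)
  open import Data.Fin.Permutation using (Permutation′; _⟨$⟩ʳ_; _⟨$⟩ˡ_; inverseˡ; inverseʳ)
  open import Data.Product using (∃; _,_; proj₁; proj₂)
  import Relation.Binary.PropositionalEquality as ≡
  open OrderedFieldProperties F using (totalOrder)
  open FinOrder totalOrder using (StrictlyIncreasing; sortingPermutation; increasing⇒reflects-<)
  open Geometry F using (NC; _~NC_)
  open Configuration F T
  open Partitions
  open StandardIntervalPartitions using (IntervalPartition; count; hasCard)

  σ : Permutation′ n
  σ = proj₁ (sortingPermutation τ τ-injective)

  σ-increasing : StrictlyIncreasing (λ r → τ (σ ⟨$⟩ʳ r))
  σ-increasing = proj₂ (sortingPermutation τ τ-injective)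

  σ⁻¹-monotone : ∀ {u v} → u ≺ v → σ ⟨$⟩ˡ u Fin.< σ ⟨$⟩ˡ v
  σ⁻¹-monotone u≺v = increasing⇒reflects-< σ-increasing (≡.subst₂ _≺_ (≡.sym (inverseʳ σ)) (≡.sym (inverseʳ σ)) u≺v)

  σ⁺ σ⁻ : Fin (suc n) → Fin (suc n)
  σ⁺ = Fin.lift 1 (σ ⟨$⟩ʳ_)
  σ⁻ = Fin.lift 1 (σ ⟨$⟩ˡ_)

  σ⁻∘σ⁺ : ∀ a → σ⁻ (σ⁺ a) ≡ a
  σ⁻∘σ⁺ zero    = ≡.refl
  σ⁻∘σ⁺ (suc a) = ≡.cong suc (inverseˡ σ)

  σ⁺∘σ⁻ : ∀ a → σ⁺ (σ⁻ a) ≡ a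
  σ⁺∘σ⁻ zero    = ≡.refl
  σ⁺∘σ⁻ (suc a) = ≡.cong suc (inverseʳ σ)

  HasCard-NC : HasCard (NC T) (_~NC_ {T = T}) (count n)
  HasCard-NC = HasCard-map-≋ {_~_ = _≋_} toNC (λ {x} {y} → pullback-resp σ⁻ (proj₁ x) (proj₁ y))
                             (λ x y → pullback-injective σ⁻ σ⁺ σ⁻∘σ⁺ (proj₁ x) (proj₁ y)) toNC-surjective (hasCard n)
    where
    toNC : IntervalPartition n → NC T
    toNC (π , I) = pullback σ⁻ π ,
                   intervals⇒noncrossing (pullback σ⁻ π) (IntervalBlocks-pullback (σ ⟨$⟩ˡ_) σ⁻¹-monotone {π} I)
    toNC-surjective : ∀ z → ∃ λ x → _~NC_ {T = T} (toNC x) z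
    toNC-surjective (π , nc) =
      (pullback σ⁺ π , IntervalBlocks-pullback (σ ⟨$⟩ʳ_) σ-increasing {π} (noncrossing⇒intervals π nc)) ,
      pullback-cong π (λ a → σ⁺ (σ⁻ a)) (λ a → a) σ⁺∘σ⁻

proposition2p11 : ∀ {c ℓ₁ ℓ₂} (F : OrderedField c ℓ₁ ℓ₂) →
    Σ (ℕ → ℕ) λ t →
      (∀ n (T : Geometry.Config F n) →
         HasCard (Geometry.NC F T) (Geometry._~NC_ F {T = T}) (t n)) ×
      (∀ k → (gf t ⋆ ((oneₛ ⊖ₛ ((+ 2) ·ₛ Xₛ)) ⋆ (oneₛ ⊖ₛ ((+ 2) ·ₛ Xₛ)))) k
             ≡ ((oneₛ ⊖ₛ Xₛ) ⋆ (oneₛ ⊖ₛ Xₛ)) k)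
proposition2p11 F = count , (λ n T → HasCard-NC F T) , gf-from-recurrence count refl refl refl count-recurrence
  where
  open StandardIntervalPartitions using (count; count-recurrence)
  open CauchyProduct using (gf-from-recurrence)
  open NoncrossingCount using (HasCard-NC)
  open import Relation.Binary.PropositionalEquality using (refl)
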